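{- Let $m\in\mathbb{Z}\setminus\{0,4\}$, $p$ a finite prime, and $\omega_1,\omega_2,\omega_3\in\mathbb{Z}_{\ge2}\cup\{\infty\}$ with at least one finite. Then there exists $M_p\in(\mathcal{X}_m,\mathcal{D}_{\underline\omega})^*_{\mathrm{str}}(\mathbb{Z}_p)$ such that $\mathrm{inv}_p\alpha_{1,- }(M_p)=\mathrm{inv}_p\alpha_{2,- }(M_p)=\mathrm{inv}_p\alpha_{3,- }(M_p)=0$. Moreover, if $\omega_i$ is finite and $v_p(m-4)$ is odd, there exists $N_p\in(\mathcal{X}_m,\mathcal{D}_{\underline\omega})^*_{\mathrm{str}}(\mathbb{Z}_p)$ with $\mathrm{inv}_p\alpha_{i,- }(N_p)=1/2$. (This holds for both Campana and Darmon points.)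
   Context: $U_m\subset\mathbb{A}^3_{\mathbb{Q}}$: $u_1^2+u_2^2+u_3^2-u_1u_2u_3=m$. $\mathcal{X}_m\subset\mathbb{P}^3_{\mathbb{Z}}$: $x_0(x_1^2+x_2^2+x_3^2)-x_1x_2x_3=mx_0^3$, generic fibre $X_m$, $U_m=X_m\cap\{x_0\ne0\}$ via $u_l=x_l/x_0$. $D_l=\{x_0=x_l=0\}$, $\mathcal{D}_l$ its closure in $\mathcal{X}_m$, $\mathcal{D}_{\underline\omega}=\sum(1-1/\omega_l)\mathcal{D}_l$, $\mathcal{D}_{\inf}=\bigcup_{\omega_l=\infty}\mathcal{D}_l$. For $M_p\in\mathcal{X}_m(\mathbb{Z}_p)$ with $\mathrm{Spec}\,\mathbb{Z}_p\times_{\mathcal{X}_m}\mathcal{D}_l=\mathrm{Spec}(\mathbb{Z}_p/I)$, $n_p(\mathcal{D}_l,M_p)=\infty$ if $I=0$, $=n$ if $I=(p^n)$. $(\mathcal{X}_m,\mathcal{D}_{\underline\omega})^*_{\mathrm{str}}(\mathbb{Z}_p)$ is the set of $M_p\in(\mathcal{X}_m\setminus\mathcal{D}_{\inf})(\mathbb{Z}_p)$ lying in $U_m(\mathbb{Q}_p)$ with $n_p(\mathcal{D}_l,M_p)\in\mathbb{Z}_{\ge\omega_l}\cup\{0,\infty\}$ (Campana) resp. $\in\omega_l\mathbb{Z}_{\ge0}\cup\{\infty\}$ (Darmon) for each $l$ with $\omega_l<\infty$. For $l=1,2,3$, $\alpha_{l,- }\in\mathrm{Br}\,U_m$ is the class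 given (on $u_l\ne2$) by the quaternion algebra $(u_l-2,m-4)$, so $\mathrm{inv}_p\alpha_{l,- }(M)=\frac{1-(u_l(M)-2,m-4)_p}{4}$ for $M\in U_m(\mathbb{Q}_p)$ with $u_l(M)\ne2$, where $(\cdot,\cdot)_p$ is the Hilbert symbol and $\mathrm{inv}_p:\mathrm{Br}\,\mathbb{Q}_p\to\mathbb{Q}/\mathbb{Z}$ the local invariant. -}

module Defs where

open import Data.Nat as ℕ using (ℕ; zero; suc; _^_; _≤_)
open import Data.Nat.Divisibility as ℕD using ()
open import Data.Integer as ℤ using (ℤ; +_; _-_; _*_; _+_)
open import Data.Integer.Divisibility using (_∣_)
open import Data.Fin using (Fin)
import Data.Fin as F
open import Data.Maybe using (Maybe; just; nothing)
open import Data.Product using (Σ; ∃; _×_)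
open import Data.Sum using (_⊎_)
open import Relation.Nullary using (¬_)
open import Relation.Binary.PropositionalEquality using (_≡_)

-- p-adic integers as coherent sequences of integers
-- (a ∈ ℤₚ is represented by a : ℕ → ℤ with a (n+1) ≡ a n mod pⁿ;
--  a n is then a representative of the residue of a mod pⁿ).

Seq : Set
Seq = ℕ → ℤ

record ℤₚ (p : ℕ) : Set where
  constructor mkℤₚ
  field
    seq : Seq
    coh : ∀ n → (+ (p ^ n)) ∣ (seq (suc n) - seq n)
open ℤₚ public

module _ (p : ℕ) where
  _≈ₚ_ : Seq → Seq → Set
  a ≈ₚ b = ∀ n → (+ (p ^ n)) ∣ (a n - b n)

cst : ℤ → Seq
cst c = λ _ → c

_⊕_ : Seq → Seq → Seq
(a ⊕ b) n = a n + b n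

_⊖_ : Seq → Seq → Seq
(a ⊖ b) n = a n - b n

_⊗_ : Seq → Seq → Seq
(a ⊗ b) n = a n * b n

infixl 6 _⊕_ _⊖_
infixl 7 _⊗_

module _ (p : ℕ) where
  DivBy : ℕ → Seq → Set
  DivBy k a = (+ (p ^ k)) ∣ a k

  IsUnit : Seq → Set
  IsUnit a = ¬ DivBy 1 a

-- ℤₚ-points of 𝒳ₘ ⊂ ℙ³_ℤ : x₀(x₁²+x₂²+x₃²) - x₁x₂x₃ = m x₀³,
-- given by a primitive homogeneous coordinate vector (x₀:x₁:x₂:x₃).

record Point (p : ℕ) (m : ℤ) : Set where
  field
    x         : Fin 4 → ℤₚ p
    prim      : ∃ λ i → IsUnit p (seq (x i))
    onX       : _≈ₚ_ p
      (seq (x F.zero) ⊗ (seq (x (F.suc F.zero)) ⊗ seq (x (F.suc F.zero))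
                         ⊕ seq (x (F.suc (F.suc F.zero))) ⊗ seq (x (F.suc (F.suc F.zero)))
                         ⊕ seq (x (F.suc (F.suc (F.suc F.zero)))) ⊗ seq (x (F.suc (F.suc (F.suc F.zero)))))
       ⊖ seq (x (F.suc F.zero)) ⊗ seq (x (F.suc (F.suc F.zero))) ⊗ seq (x (F.suc (F.suc (F.suc F.zero)))))
      (cst m ⊗ seq (x F.zero) ⊗ seq (x F.zero) ⊗ seq (x F.zero))
open Point public

module _ {p : ℕ} {m : ℤ} (M : Point p m) where
  -- x₀ and xₗ (l = 1,2,3 encoded as Fin 3 = 0,1,2)
  X0 : Seq
  X0 = seq (x M F.zero)

  Xl : Fin 3 → Seq
  Xl l = seq (x M (F.suc l))

  -- M lies in Uₘ(ℚₚ), i.e. x₀ ≠ 0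
  InU : Set
  InU = ¬ (_≈ₚ_ p X0 (cst (+ 0)))

  -- n_p(𝒟ₗ, M) = n : the ideal (x₀, xₗ) of ℤₚ (pull-back of the ideal of
  -- 𝒟ₗ = closure of {x₀ = xₗ = 0}) equals (pⁿ).  n_p = ∞ iff no such n.
  NP : Fin 3 → ℕ → Set
  NP l n = DivBy p n X0 × DivBy p n (Xl l)
         × ¬ (DivBy p (suc n) X0 × DivBy p (suc n) (Xl l))

data Kind : Set where
  campana darmon : Kind

-- allowed finite multiplicities for weight ω (∞ is always allowed)
Allowed : Kind → ℕ → ℕ → Set
Allowed campana ω n = n ≡ 0 ⊎ ω ≤ n
Allowed darmon  ω n = ω ℕD.∣ n

-- weights ω : Fin 3 → Maybe ℕ, nothing = ∞
module _ {p : ℕ} {m : ℤ} where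
  CondAt : Kind → Maybe ℕ → Point p m → Fin 3 → Set
  CondAt k nothing  M l = NP M l 0                          -- M does not meet 𝒟ₗ ⊂ 𝒟_inf
  CondAt k (just ω) M l = ∀ n → NP M l n → Allowed k ω n

  StrPoint : Kind → (Fin 3 → Maybe ℕ) → Point p m → Set
  StrPoint k ω M = InU M × (∀ l → CondAt k (ω l) M l)

-- (a/c, b)ₚ = 1 for a, b, c ∈ ℤₚ, c ≠ 0: z² = (a/c)X² + bY² has a nontrivial
-- solution in ℚₚ; equivalently (scaling) in ℤₚ, denominators cleared:
-- c Z² = a X² + c b Y².
HilbertOne : (p : ℕ) → Seq → Seq → Seq → Set
HilbertOne p a c b = Σ (ℤₚ p) λ X → Σ (ℤₚ p) λ Y → Σ (ℤₚ p) λ Z →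
    ¬ (_≈ₚ_ p (seq X) (cst (+ 0)) × _≈ₚ_ p (seq Y) (cst (+ 0)) × _≈ₚ_ p (seq Z) (cst (+ 0)))
  × _≈ₚ_ p (c ⊗ seq Z ⊗ seq Z) (a ⊗ seq X ⊗ seq X ⊕ c ⊗ b ⊗ seq Y ⊗ seq Y)

module _ {p : ℕ} {m : ℤ} (M : Point p m) (l : Fin 3) where
  Ul≠2 : Set
  Ul≠2 = ¬ (_≈ₚ_ p (Xl M l) (cst (+ 2) ⊗ X0 M))

  -- (uₗ(M) - 2, m - 4)ₚ = 1, with uₗ - 2 = (xₗ - 2x₀)/x₀
  SymbolOne : Set
  SymbolOne = HilbertOne p (Xl M l ⊖ cst (+ 2) ⊗ X0 M) (X0 M) (cst (m - + 4))

  -- inv_p α_{l,-}(M) = 0  resp. = 1/2  (evaluated by the quaternion algebra formula)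
  Inv0 : Set
  Inv0 = Ul≠2 × SymbolOne

  InvHalf : Set
  InvHalf = Ul≠2 × ¬ SymbolOne

OddVal : ℕ → ℤ → Set
OddVal p z = ∃ λ k → (+ (p ^ suc (2 ℕ.* k))) ∣ z × ¬ ((+ (p ^ suc (suc (2 ℕ.* k)))) ∣ z)

{-# OPTIONS --safe #-}
-- The points are taken from the family x = (c κ : (1 + c²) κ : c (G + H) : c² G + H), placed so
-- that u_i = c + 1/c for the index i with ω_i finite. Along the family the surface equation
-- reduces to κ² G₀ = A² G H, where A = c² − 1 and G₀ = A² − c² (m − 4). Taking κ = p^ν · unit,
-- G a unit and p ∣ H gives a primitive point whose only boundary multiplicity is n_p(D_i) = ν,
-- which we choose to be a positive multiple of ω_i; such a point is both Campana and Darmon.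
-- Since u_i − 2 = (c − 1)²/c, the symbol α_{i,−} is (c, m − 4).
--
-- For trivial symbols take c = q² with q⁴ ≡ 1 modulo a high power of p; with the scaling
-- ℓ = −A (m − 4) also x₀ (x_j − 2 x₀) and x₀ (x_k − 2 x₀) are explicit norms Z² − (m − 4) Y².
-- For the nontrivial symbol take c a unit generating the unramified quadratic extension of ℚ_p
-- (a quadratic nonresidue for odd p, c = 5 for p = 2). As v_p(m − 4) is odd, p-adic descent on
-- c Z² − W² − c (m − 4) Y² shows that (c, m − 4)_p = −1.
module Submission where

open import Defs
open import Data.Nat as ℕ using (ℕ; zero; suc; _≤_; _<_; z≤n; s≤s)
import Data.Nat.Properties as ℕ
import Data.Nat.Divisibility as ℕ
import Data.Nat.GCD as ℕ
import Data.Nat.Tactic.RingSolver as ℕ-Solver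
open import Data.Nat.Primality using (Prime; euclidsLemma; prime⇒nonZero; prime⇒nonTrivial; prime⇒irreducible)
open import Data.Nat.Coprimality using (coprime-Bézout; prime⇒coprime)
open import Data.Integer as ℤ using (ℤ; +_; _+_; _-_; _*_; -_; 0ℤ; 1ℤ)
import Data.Integer.Properties as ℤ
import Data.Integer.DivMod as ℤ
open import Data.Integer.Divisibility.Signed
open import Data.Integer.Tactic.RingSolver using (solve-∀)
open import Data.Fin as Fin using (Fin; zero; suc; toℕ)
import Data.Fin.Properties as Fin
open import Data.Maybe using (Maybe; just; nothing)
open import Data.Product using (∃; ∃₂; _×_; _,_; proj₁; proj₂)
open import Data.Sum using (_⊎_; inj₁; inj₂)
open import Function using (_∘_)
open import Relation.Nullary using (¬_; Dec; yes; no; contradiction)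
open import Relation.Nullary.Decidable using (decidable-stable; from-yes)
open import Relation.Binary.PropositionalEquality
open import Relation.Binary.Definitions using (tri<; tri≈; tri>)
open ≡-Reasoning

_∣0 : ∀ k → k ∣ 0ℤ
k ∣0 = divides 0ℤ refl

1∣_ : ∀ k → 1ℤ ∣ k
1∣ k = divides k (sym (ℤ.*-identityʳ k))

*-≢0 : ∀ {a b} → a ≢ 0ℤ → b ≢ 0ℤ → a * b ≢ 0ℤ
*-≢0 {a} a≢0 b≢0 ab≡0 with ℤ.i*j≡0⇒i≡0∨j≡0 a ab≡0
... | inj₁ a≡0 = a≢0 a≡0
... | inj₂ b≡0 = b≢0 b≡0

*-pres-∣ : ∀ {i j a b} → i ∣ a → j ∣ b → i * j ∣ a * b
*-pres-∣ {j = j} {a} i∣a j∣b = ∣-trans (*-monoˡ-∣ j i∣a) (*-monoʳ-∣ a j∣b)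

parity : ∀ n → ∃ λ h → n ≡ h ℕ.+ h ⊎ n ≡ suc (h ℕ.+ h)
parity zero = 0 , inj₁ refl
parity (suc n) with parity n
... | h , inj₁ refl = h , inj₂ refl
... | h , inj₂ refl = suc h , inj₁ (cong suc (sym (ℕ.+-suc h h)))

+[m+n]-+m≡+n : ∀ m k → + (m ℕ.+ k) - + m ≡ + k
+[m+n]-+m≡+n m k = trans (cong (_- + m) (ℤ.pos-+ m k)) (identity (+ m) (+ k))
  where
  identity : ∀ m k → m + k - m ≡ k
  identity = solve-∀

even≢odd : ∀ a k → a ℕ.+ a ≢ suc (k ℕ.+ k)
even≢odd zero    k       ()
even≢odd (suc a) zero    2a+2≡1 = ℕ.0≢1+n (sym (ℕ.suc-injective (trans (sym (ℕ.+-suc (suc a) a)) 2a+2≡1)))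
even≢odd (suc a) (suc k) eq = even≢odd a k (ℕ.suc-injective
  (trans (sym (ℕ.+-suc a a)) (trans (ℕ.suc-injective eq) (cong suc (ℕ.+-suc k k)))))

-- Divisibility by powers of p

module PrimePowers (p : ℕ) (p-prime : Prime p) where

  pℤ : ℤ
  pℤ = + p

  infix 8 p^_
  p^_ : ℕ → ℤ
  p^ n = + (p ℕ.^ n)

  Unit : ℤ → Set
  Unit u = ¬ pℤ ∣ u

  p>1 : 1 < p
  p>1 = ℕ.nonTrivial⇒n>1 p {{prime⇒nonTrivial p-prime}}

  p^n>0 : ∀ n → 0 < p ℕ.^ n
  p^n>0 = ℕ.m^n>0 p {{prime⇒nonZero p-prime}}

  n<p^n : ∀ n → n < p ℕ.^ n
  n<p^n zero = s≤s z≤n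
  n<p^n (suc n) = ℕ.≤-trans (subst (_≤ q ℕ.+ q) (ℕ.+-comm (suc n) 1) (ℕ.+-mono-≤ (n<p^n n) (p^n>0 n)))
                            (ℕ.≤-trans (ℕ.≤-reflexive (cong (q ℕ.+_) (sym (ℕ.+-identityʳ q))))
                                       (ℕ.*-monoˡ-≤ q p>1))
    where
    q = p ℕ.^ n

  p^-+ : ∀ m n → p^ (m ℕ.+ n) ≡ p^ m * p^ n
  p^-+ m n = trans (cong +_ (ℕ.^-distribˡ-+-* p m n)) (ℤ.pos-* (p ℕ.^ m) (p ℕ.^ n))

  p^-+³ : ∀ x y z → p^ (x ℕ.+ y ℕ.+ z) ≡ p^ x * p^ y * p^ z
  p^-+³ x y z = trans (p^-+ (x ℕ.+ y) z) (cong (_* p^ z) (p^-+ x y))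

  p^-suc : ∀ n → p^ suc n ≡ pℤ * p^ n
  p^-suc n = ℤ.pos-* p (p ℕ.^ n)

  p^-suc′ : ∀ n → p^ suc n ≡ p^ n * pℤ
  p^-suc′ n = trans (p^-suc n) (ℤ.*-comm pℤ (p^ n))

  p^1 : p^ 1 ≡ pℤ
  p^1 = cong +_ (ℕ.*-identityʳ p)

  p^2≡ : p^ 2 ≡ pℤ * pℤ
  p^2≡ = trans (p^-suc 1) (cong (pℤ *_) p^1)

  p^-nonZero : ∀ n → ℤ.NonZero (p^ n)
  p^-nonZero n = ℕ.>-nonZero (p^n>0 n)

  p^≢0 : ∀ n → p^ n ≢ 0ℤ
  p^≢0 n eq = ℕ.<⇒≢ (p^n>0 n) (sym (ℤ.+-injective eq))

  p^-mono-∣ : ∀ {m n} → m ≤ n → p^ m ∣ p^ n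
  p^-mono-∣ {m} m≤n with ℕ.m≤n⇒∃[o]m+o≡n m≤n
  ... | o , refl = divides (p^ o) (trans (p^-+ m o) (ℤ.*-comm (p^ m) (p^ o)))

  p∣p^ : ∀ n → 1 ≤ n → pℤ ∣ p^ n
  p∣p^ n 1≤n = subst (_∣ p^ n) p^1 (p^-mono-∣ 1≤n)

  p^∣p^* : ∀ n u → p^ n ∣ p^ n * u
  p^∣p^* n u = ∣m⇒∣m*n u ∣-refl

  p^∣⇒p^suc∣*p : ∀ n {a} → p^ n ∣ a → p^ suc n ∣ a * pℤ
  p^∣⇒p^suc∣*p n p^n∣a = subst (_∣ _) (sym (p^-suc′ n)) (*-monoˡ-∣ pℤ p^n∣a)

  p^-cancelˡ-∣ : ∀ k n {a} → p^ (k ℕ.+ n) ∣ p^ k * a → p^ n ∣ a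
  p^-cancelˡ-∣ k n p^∣ = *-cancelˡ-∣ (p^ k) {{p^-nonZero k}} (subst (_∣ _) (p^-+ k n) p^∣)

  p^suc-cancel-∣ : ∀ n {a} → p^ suc n ∣ pℤ * a → p^ n ∣ a
  p^suc-cancel-∣ n p^∣ = *-cancelˡ-∣ pℤ {{prime⇒nonZero p-prime}} (subst (_∣ _) (p^-suc n) p^∣)

  p∣2⇒p≡2 : pℤ ∣ + 2 → p ≡ 2
  p∣2⇒p≡2 p∣2 = ℕ.≤-antisym (ℕ.∣⇒≤ (∣⇒∣ᵤ {pℤ} {+ 2} p∣2)) p>1

  p∣m*n⇒p∣m⊎p∣n : ∀ a b → pℤ ∣ a * b → pℤ ∣ a ⊎ pℤ ∣ b
  p∣m*n⇒p∣m⊎p∣n a b p∣ab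
    with euclidsLemma ℤ.∣ a ∣ ℤ.∣ b ∣ p-prime (subst (p ℕ.∣_) (ℤ.abs-* a b) (∣⇒∣ᵤ p∣ab))
  ... | inj₁ p∣a = inj₁ (∣ᵤ⇒∣ p∣a)
  ... | inj₂ p∣b = inj₂ (∣ᵤ⇒∣ p∣b)

  p∣m*m⇒p∣m : ∀ a → pℤ ∣ a * a → pℤ ∣ a
  p∣m*m⇒p∣m a p∣aa with p∣m*n⇒p∣m⊎p∣n a a p∣aa
  ... | inj₁ p∣a = p∣a
  ... | inj₂ p∣a = p∣a

  Unit-* : ∀ {u v} → Unit u → Unit v → Unit (u * v)
  Unit-* {u} {v} u-unit v-unit p∣uv with p∣m*n⇒p∣m⊎p∣n u v p∣uv
  ... | inj₁ p∣u = u-unit p∣u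
  ... | inj₂ p∣v = v-unit p∣v

  Unit-neg : ∀ {u} → Unit u → Unit (- u)
  Unit-neg {u} u-unit p∣-u = u-unit (subst (pℤ ∣_) (ℤ.neg-involutive u) (∣m⇒∣-m p∣-u))

  Unit-1 : Unit 1ℤ
  Unit-1 p∣1 = ℕ.<⇒≱ p>1 (ℕ.∣⇒≤ (∣⇒∣ᵤ {pℤ} {1ℤ} p∣1))

  Unit-≡-mod-p : ∀ {u v} → Unit u → pℤ ∣ v - u → Unit v
  Unit-≡-mod-p {u} {v} u-unit p∣v-u p∣v =
    u-unit (subst (pℤ ∣_) (identity u v) (∣m∣n⇒∣m-n p∣v p∣v-u))
    where
    identity : ∀ u v → v - (v - u) ≡ u
    identity = solve-∀

  Unit-1+ : ∀ {x} → pℤ ∣ x → Unit (1ℤ + x)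
  Unit-1+ {x} p∣x = Unit-≡-mod-p Unit-1 (subst (pℤ ∣_) (sym (identity x)) p∣x)
    where
    identity : ∀ x → 1ℤ + x - 1ℤ ≡ x
    identity = solve-∀

  Unit⇒≢0 : ∀ {u} → Unit u → u ≢ 0ℤ
  Unit⇒≢0 u-unit refl = u-unit (pℤ ∣0)

  Unit-cancel-∣ : ∀ {u} a → Unit u → pℤ ∣ u * a → pℤ ∣ a
  Unit-cancel-∣ {u} a u-unit p∣ua with p∣m*n⇒p∣m⊎p∣n u a p∣ua
  ... | inj₁ p∣u = contradiction p∣u u-unit
  ... | inj₂ p∣a = p∣a

  Unit-cancel-p^∣ : ∀ n {u} a → Unit u → p^ n ∣ u * a → p^ n ∣ a
  Unit-cancel-p^∣ zero a u-unit _ = 1∣ a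
  Unit-cancel-p^∣ (suc n) {u} a u-unit p^∣ua
    with Unit-cancel-∣ a u-unit (∣-trans (p∣p^ (suc n) (s≤s z≤n)) p^∣ua)
  ... | divides b refl =
    subst (_∣ b * pℤ) (trans (ℤ.*-comm (p^ n) pℤ) (sym (p^-suc n)))
      (*-monoˡ-∣ pℤ (Unit-cancel-p^∣ n b u-unit p^n∣ub))
    where
    regroup : ∀ u b p → u * (b * p) ≡ p * (u * b)
    regroup = solve-∀
    p^n∣ub : p^ n ∣ u * b
    p^n∣ub = *-cancelˡ-∣ pℤ {{prime⇒nonZero p-prime}}
               (subst₂ _∣_ (p^-suc n) (regroup u b pℤ) p^∣ua)

  p^*unit-exact : ∀ ν {u} → Unit u → ¬ p^ suc ν ∣ p^ ν * u
  p^*unit-exact ν {u} u-unit p^ν+1∣ =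
    u-unit (*-cancelˡ-∣ (p^ ν) {{p^-nonZero ν}} (subst (_∣ p^ ν * u) (p^-suc′ ν) p^ν+1∣))

  p^*unit≢0 : ∀ ν {u} → Unit u → p^ ν * u ≢ 0ℤ
  p^*unit≢0 ν u-unit eq = p^*unit-exact ν u-unit (subst (_ ∣_) (sym eq) ((p^ suc ν) ∣0))

  p^*unit-injective : ∀ {i j u v} → Unit u → Unit v → p^ i * u ≡ p^ j * v → i ≡ j
  p^*unit-injective {i} {j} {u} {v} u-unit v-unit eq with ℕ.<-cmp i j
  ... | tri≈ _ i≡j _ = i≡j
  ... | tri< i<j _ _ = contradiction (subst (_ ∣_) (sym eq) (∣-trans (p^-mono-∣ i<j) (p^∣p^* j v)))
                                     (p^*unit-exact i u-unit)
  ... | tri> _ _ j<i = contradiction (subst (_ ∣_) eq (∣-trans (p^-mono-∣ j<i) (p^∣p^* i u)))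
                                     (p^*unit-exact j v-unit)

  largest-common-p^≡ : ∀ {a b ν n} → p^ ν ∣ a → ¬ p^ suc ν ∣ a → p^ ν ∣ b →
    p^ n ∣ a → p^ n ∣ b → ¬ (p^ suc n ∣ a × p^ suc n ∣ b) → n ≡ ν
  largest-common-p^≡ {ν = ν} {n} p^ν∣a p^ν+1∤a p^ν∣b p^n∣a p^n∣b p^n+1∤ with ℕ.<-cmp n ν
  ... | tri≈ _ n≡ν _ = n≡ν
  ... | tri< n<ν _ _ = contradiction (∣-trans (p^-mono-∣ n<ν) p^ν∣a , ∣-trans (p^-mono-∣ n<ν) p^ν∣b) p^n+1∤
  ... | tri> _ _ ν<n = contradiction (∣-trans (p^-mono-∣ ν<n) p^n∣a) p^ν+1∤a

  Unit-p^∣⇒≡0 : ∀ {u} n → Unit u → p^ n ∣ u → n ≡ 0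
  Unit-p^∣⇒≡0 zero    u-unit _      = refl
  Unit-p^∣⇒≡0 (suc n) u-unit p^n∣u = contradiction (∣-trans (p∣p^ (suc n) (s≤s z≤n)) p^n∣u) u-unit

  private
    largest-power : ∀ z N → ¬ p^ N ∣ z → ∃ λ ν → p^ ν ∣ z × ¬ p^ suc ν ∣ z
    largest-power z zero p^0∤z = contradiction (1∣ z) p^0∤z
    largest-power z (suc N) p^N+1∤z with p^ N ∣? z
    ... | yes p^N∣z = N , p^N∣z , p^N+1∤z
    ... | no p^N∤z = largest-power z N p^N∤z

  record Valuation (z : ℤ) : Set where
    field
      ν      : ℕ
      u      : ℤ
      z≡p^ν*u : z ≡ p^ ν * u
      u-unit : Unit u

  valuation : ∀ {z} → z ≢ 0ℤ → Valuation z
  valuation {z} z≢0 with largest-power z ℤ.∣ z ∣ p^∣z∣∤z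
    where
    p^∣z∣∤z : ¬ p^ ℤ.∣ z ∣ ∣ z
    p^∣z∣∤z p^∣z∣∣z = ℕ.<⇒≱ (n<p^n ℤ.∣ z ∣)
      (ℕ.∣⇒≤ {{ℕ.≢-nonZero (z≢0 ∘ ℤ.∣i∣≡0⇒i≡0)}} (∣⇒∣ᵤ p^∣z∣∣z))
  ... | ν , divides u refl , p^ν+1∤z = record
    { ν = ν ; u = u ; z≡p^ν*u = ℤ.*-comm u (p^ ν)
    ; u-unit = λ p∣u → p^ν+1∤z (subst (_∣ u * p^ ν) (sym (p^-suc ν)) (*-monoˡ-∣ (p^ ν) p∣u)) }

  ≢0⇒¬∀p^∣ : ∀ {z} → z ≢ 0ℤ → ¬ (∀ n → p^ n ∣ z)
  ≢0⇒¬∀p^∣ z≢0 ∀p^∣z =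
    let open Valuation (valuation z≢0) in p^*unit-exact ν u-unit (subst (p^ suc ν ∣_) z≡p^ν*u (∀p^∣z (suc ν)))

-- ℤₚ-points with integer coordinates

allowed-zero : ∀ k w → Allowed k w 0
allowed-zero campana w = inj₁ refl
allowed-zero darmon  w = w ℕ.∣0

allowed-multiple : ∀ k w r → Allowed k w (w ℕ.* suc r)
allowed-multiple campana w r = inj₂ (ℕ.m≤m*n w (suc r))
allowed-multiple darmon  w r = ℕ.m∣m*n (suc r)

record Quad : Set where
  constructor quad
  field
    x₀ xᵢ xⱼ xₖ : ℤ
open Quad public

OnSurface : ℤ → Quad → Set
OnSurface m (quad x₀ xᵢ xⱼ xₖ) =
  x₀ * (xᵢ * xᵢ + xⱼ * xⱼ + xₖ * xₖ) - xᵢ * xⱼ * xₖ ≡ m * x₀ * x₀ * x₀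

at : Fin 3 → Quad → Fin 3 → ℤ
at zero             q zero             = xᵢ q
at zero             q (suc zero)       = xⱼ q
at zero             q (suc (suc zero)) = xₖ q
at (suc zero)       q zero             = xₖ q
at (suc zero)       q (suc zero)       = xᵢ q
at (suc zero)       q (suc (suc zero)) = xⱼ q
at (suc (suc zero)) q zero             = xⱼ q
at (suc (suc zero)) q (suc zero)       = xₖ q
at (suc (suc zero)) q (suc (suc zero)) = xᵢ q

next : Fin 3 → Fin 3
next zero             = suc zero
next (suc zero)       = suc (suc zero)
next (suc (suc zero)) = zero

at-next : ∀ i q → at i q (next i) ≡ xⱼ q
at-next zero             q = refl
at-next (suc zero)       q = refl
at-next (suc (suc zero)) q = refl

at-self : ∀ i q → at i q i ≡ xᵢ q
at-self zero             q = refl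
at-self (suc zero)       q = refl
at-self (suc (suc zero)) q = refl

at-other : ∀ (P : ℤ → Set) {q} → P (xⱼ q) → P (xₖ q) → ∀ i l → l ≢ i → P (at i q l)
at-other P Pⱼ Pₖ zero             zero             l≢i = contradiction refl l≢i
at-other P Pⱼ Pₖ zero             (suc zero)       _   = Pⱼ
at-other P Pⱼ Pₖ zero             (suc (suc zero)) _   = Pₖ
at-other P Pⱼ Pₖ (suc zero)       zero             _   = Pₖ
at-other P Pⱼ Pₖ (suc zero)       (suc zero)       l≢i = contradiction refl l≢i
at-other P Pⱼ Pₖ (suc zero)       (suc (suc zero)) _   = Pⱼ
at-other P Pⱼ Pₖ (suc (suc zero)) zero             _   = Pⱼ
at-other P Pⱼ Pₖ (suc (suc zero)) (suc zero)       _   = Pₖ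
at-other P Pⱼ Pₖ (suc (suc zero)) (suc (suc zero)) l≢i = contradiction refl l≢i

at-all : ∀ (P : ℤ → Set) {q} → P (xᵢ q) → P (xⱼ q) → P (xₖ q) → ∀ i l → P (at i q l)
at-all P {q} Pᵢ Pⱼ Pₖ i l with l Fin.≟ i
... | yes refl = subst P (sym (at-self i q)) Pᵢ
... | no l≢i = at-other P Pⱼ Pₖ i l l≢i

at-on-surface : ∀ m i q → OnSurface m q →
  let y = at i q in
  x₀ q * (y zero * y zero + y (suc zero) * y (suc zero) + y (suc (suc zero)) * y (suc (suc zero)))
    - y zero * y (suc zero) * y (suc (suc zero)) ≡ m * x₀ q * x₀ q * x₀ q
at-on-surface m zero             (quad x₀ xᵢ xⱼ xₖ) eq = eq
at-on-surface m (suc zero)       (quad x₀ xᵢ xⱼ xₖ) eq = trans (rotate x₀ xᵢ xⱼ xₖ) eq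
  where
  rotate : ∀ x₀ xᵢ xⱼ xₖ → x₀ * (xₖ * xₖ + xᵢ * xᵢ + xⱼ * xⱼ) - xₖ * xᵢ * xⱼ
                         ≡ x₀ * (xᵢ * xᵢ + xⱼ * xⱼ + xₖ * xₖ) - xᵢ * xⱼ * xₖ
  rotate = solve-∀
at-on-surface m (suc (suc zero)) (quad x₀ xᵢ xⱼ xₖ) eq = trans (rotate x₀ xᵢ xⱼ xₖ) eq
  where
  rotate : ∀ x₀ xᵢ xⱼ xₖ → x₀ * (xⱼ * xⱼ + xₖ * xₖ + xᵢ * xᵢ) - xⱼ * xₖ * xᵢ
                         ≡ x₀ * (xᵢ * xᵢ + xⱼ * xⱼ + xₖ * xₖ) - xᵢ * xⱼ * xₖ
  rotate = solve-∀

-- (v/x₀ − 2, D) is trivial when x₀ (v − 2 x₀) is a norm Z² − D Y²; it suffices to exhibit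
-- the norm for a multiple (X₀, V) of (x₀, v).
hilbert-of-norm : ∀ {δ x₀ v X₀ V} D Y Z → δ ≢ 0ℤ → δ * x₀ ≡ X₀ → δ * v ≡ V →
  X₀ * (V - + 2 * X₀) ≡ Z * Z - D * Y * Y →
  x₀ * Z * Z ≡ (v - + 2 * x₀) * X₀ * X₀ + x₀ * D * Y * Y
hilbert-of-norm {δ} {x₀} {v} D Y Z δ≢0 refl refl norm =
  ℤ.*-cancelˡ-≡ δ _ _ {{ℤ.≢-nonZero δ≢0}} (begin
    δ * (x₀ * Z * Z)                                              ≡⟨ split δ x₀ Z D Y ⟩
    δ * x₀ * ((Z * Z - D * Y * Y) + D * Y * Y)
      ≡⟨ cong (λ N → δ * x₀ * (N + D * Y * Y)) norm ⟨
    δ * x₀ * (δ * x₀ * (δ * v - + 2 * (δ * x₀)) + D * Y * Y)      ≡⟨ regroup δ x₀ v D Y ⟩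
    δ * ((v - + 2 * x₀) * (δ * x₀) * (δ * x₀) + x₀ * D * Y * Y)   ∎)
  where
  split : ∀ δ x₀ Z D Y → δ * (x₀ * Z * Z) ≡ δ * x₀ * ((Z * Z - D * Y * Y) + D * Y * Y)
  split = solve-∀
  regroup : ∀ δ x₀ v D Y → δ * x₀ * (δ * x₀ * (δ * v - + 2 * (δ * x₀)) + D * Y * Y)
                         ≡ δ * ((v - + 2 * x₀) * (δ * x₀) * (δ * x₀) + x₀ * D * Y * Y)
  regroup = solve-∀

module Points (p : ℕ) (p-prime : Prime p) (m : ℤ) where
  open PrimePowers p p-prime

  ≡⇒≈ₚ : ∀ {a b} → a ≡ b → _≈ₚ_ p (cst a) (cst b)
  ≡⇒≈ₚ {a} refl n = ∣⇒∣ᵤ (subst (p^ n ∣_) (sym (ℤ.+-inverseʳ a)) ((p^ n) ∣0))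

  const : ℤ → ℤₚ p
  const z = mkℤₚ (cst z) (≡⇒≈ₚ {z} refl)

  ≉0 : ∀ {z} → z ≢ 0ℤ → ¬ _≈ₚ_ p (cst z) (cst 0ℤ)
  ≉0 {z} z≢0 z≈0 = ≢0⇒¬∀p^∣ z≢0 (λ n → subst (p^ n ∣_) (ℤ.+-identityʳ z) (∣ᵤ⇒∣ (z≈0 n)))

  Unit⇒IsUnit : ∀ {z} → Unit z → IsUnit p (cst z)
  Unit⇒IsUnit {z} z-unit p∣z = z-unit (subst (_∣ z) p^1 (∣ᵤ⇒∣ {p^ 1} {z} p∣z))

  coherent : ∀ (X : ℤₚ p) {j K} → j ≤ K → p^ j ∣ seq X K - seq X j
  coherent X {K = zero} z≤n = 1∣ (seq X 0 - seq X 0)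
  coherent X {j} {suc K} j≤K+1 with ℕ.m≤n⇒m<n∨m≡n j≤K+1
  ... | inj₂ refl      = subst (p^ j ∣_) (sym (ℤ.+-inverseʳ (seq X j))) ((p^ j) ∣0)
  ... | inj₁ (s≤s j≤K) = subst (p^ j ∣_) (telescope (seq X (suc K)) (seq X K) (seq X j))
    (∣m∣n⇒∣m+n (∣-trans (p^-mono-∣ j≤K) (∣ᵤ⇒∣ {p^ K} {seq X (suc K) - seq X K} (coh X K))) (coherent X j≤K))
    where
    telescope : ∀ a b c → (a - b) + (b - c) ≡ a - c
    telescope = solve-∀

  ≈0-of-deep-representatives : ∀ (X : ℤₚ p) (K : ℕ → ℕ) → (∀ j → j ≤ K j) →
    (∀ j → p^ j ∣ seq X (K j)) → _≈ₚ_ p (seq X) (cst 0ℤ)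
  ≈0-of-deep-representatives X K j≤K p^j∣ j =
    ∣⇒∣ᵤ (subst (p^ j ∣_) (identity (seq X (K j)) (seq X j)) (∣m∣n⇒∣m-n (p^j∣ j) (coherent X (j≤K j))))
    where
    identity : ∀ a b → a - (a - b) ≡ b - 0ℤ
    identity = solve-∀

  hilbert-residual : (x₀ v X Y Z : ℤ) → ℤ
  hilbert-residual x₀ v X Y Z = x₀ * Z * Z - ((v - + 2 * x₀) * X * X + x₀ * (m - + 4) * Y * Y)

  TrivialSymbol : Quad → ℤ → Set
  TrivialSymbol q v = (v - + 2 * x₀ q ≢ 0ℤ) × ∃ λ X → ∃₂ λ Y Z → X ≢ 0ℤ ×
    x₀ q * Z * Z ≡ (v - + 2 * x₀ q) * X * X + x₀ q * (m - + 4) * Y * Y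

  module _ (i : Fin 3) (q : Quad) (on-X : OnSurface m q) (xⱼ-unit : Unit (xⱼ q)) where

    point : Point p m
    point = record
      { x    = coordinates
      ; prim = suc (next i) , Unit⇒IsUnit (subst Unit (sym (at-next i q)) xⱼ-unit)
      ; onX  = ≡⇒≈ₚ (at-on-surface m i q on-X) }
      where
      coordinates : Fin 4 → ℤₚ p
      coordinates zero    = const (x₀ q)
      coordinates (suc l) = const (at i q l)

    point-str : Unit (xₖ q) → ∀ k ω {w} → ω i ≡ just w → ∀ ν {u} → x₀ q ≡ p^ ν * u → Unit u →
      p^ ν ∣ xᵢ q → Allowed k w ν → StrPoint k ω point
    point-str xₖ-unit k ω {w} ωᵢ≡w ν {u} x₀≡ u-unit p^ν∣xᵢ allowed =
      ≉0 (subst (_≢ 0ℤ) (sym x₀≡) (p^*unit≢0 ν u-unit)) , condition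
      where
      condition : ∀ l → CondAt k (ω l) point l
      condition l with l Fin.≟ i
      ... | yes refl rewrite ωᵢ≡w = λ n (p^n∣x₀ , p^n∣xᵢ , p^n+1∤) →
        subst (Allowed k w)
          (sym (largest-common-p^≡ (subst (p^ ν ∣_) (sym x₀≡) (p^∣p^* ν u))
                                   (subst (¬_ ∘ (p^ suc ν ∣_)) (sym x₀≡) (p^*unit-exact ν u-unit))
                                   (subst (p^ ν ∣_) (sym (at-self l q)) p^ν∣xᵢ)
                                   (∣ᵤ⇒∣ p^n∣x₀) (∣ᵤ⇒∣ p^n∣xᵢ)
                                   (λ (a , b) → p^n+1∤ (∣⇒∣ᵤ a , ∣⇒∣ᵤ b))))
          allowed
      ... | no l≢i with ω l
      ...   | nothing =
        ∣⇒∣ᵤ (1∣ x₀ q) , ∣⇒∣ᵤ (1∣ at i q l) , λ (_ , p∣xₗ) → Unit⇒IsUnit xₗ-unit p∣xₗ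
        where
        xₗ-unit : Unit (at i q l)
        xₗ-unit = at-other Unit xⱼ-unit xₖ-unit i l l≢i
      ...   | just w′ = λ n (_ , p^n∣xₗ , _) →
        subst (Allowed k w′) (sym (Unit-p^∣⇒≡0 n (at-other Unit xⱼ-unit xₖ-unit i l l≢i) (∣ᵤ⇒∣ p^n∣xₗ)))
          (allowed-zero k w′)

    Ul≠2-of : ∀ l → at i q l - + 2 * x₀ q ≢ 0ℤ → Ul≠2 point l
    Ul≠2-of l ≢0 ≈ = ≢0⇒¬∀p^∣ ≢0 (λ n → ∣ᵤ⇒∣ (≈ n))

    Inv0-of : TrivialSymbol q (xᵢ q) → TrivialSymbol q (xⱼ q) → TrivialSymbol q (xₖ q) → ∀ l → Inv0 point l
    Inv0-of trivialᵢ trivialⱼ trivialₖ l with at-all (TrivialSymbol q) trivialᵢ trivialⱼ trivialₖ i l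
    ... | ≢0 , X , Y , Z , X≢0 , eq =
      Ul≠2-of l ≢0 , const X , const Y , const Z , (λ (X≈0 , _) → ≉0 X≢0 X≈0) , ≡⇒≈ₚ eq

-- The family of points

surface-factorisation : ∀ m c κ G H →
  let D = m - + 4 ; A = c * c - 1ℤ ; G₀ = A * A - c * c * D
      x₀ = c * κ ; xᵢ = (1ℤ + c * c) * κ ; xⱼ = c * (G + H) ; xₖ = c * c * G + H
  in x₀ * (xᵢ * xᵢ + xⱼ * xⱼ + xₖ * xₖ) - xᵢ * xⱼ * xₖ - m * x₀ * x₀ * x₀
       ≡ c * κ * (κ * κ * G₀ - A * A * G * H)
surface-factorisation = solve-∀

-- On the unscaled parameters (κ, G, H) = (ℓ A, G₀, ℓ²), ℓ = − A D, the products x₀ (x − 2 x₀)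
-- for x = xⱼ and, when c = q², x = xₖ are norms Z² − D Y².
norm-at-xⱼ : ∀ c A D →
  let G₀ = A * A - c * c * D ; ℓ = - (A * D) ; x₀ = c * (ℓ * A) ; xⱼ = c * (G₀ + ℓ * ℓ)
  in x₀ * (xⱼ - + 2 * x₀) ≡ (c * c * A * D) * (c * c * A * D) - D * (c * A * A * (1ℤ + D)) * (c * A * A * (1ℤ + D))
norm-at-xⱼ = solve-∀

norm-at-xₖ : ∀ q A D →
  let c = q * q ; G₀ = A * A - c * c * D ; ℓ = - (A * D) ; x₀ = c * (ℓ * A) ; xₖ = c * c * G₀ + ℓ * ℓ
  in x₀ * (xₖ - + 2 * x₀) ≡ (q * c * c * A * D) * (q * c * c * A * D) - D * (q * A * A * (c + D)) * (q * A * A * (c + D))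
norm-at-xₖ = solve-∀

module Family (m c : ℤ) where

  D A G₀ : ℤ
  D  = m - + 4
  A  = c * c - 1ℤ
  G₀ = A * A - c * c * D

  quadOf : ℤ → ℤ → ℤ → Quad
  quadOf κ G H = quad (c * κ) ((1ℤ + c * c) * κ) (c * (G + H)) (c * c * G + H)

  quadOf-on-surface : ∀ {κ G H} → κ * κ * G₀ ≡ A * A * G * H → OnSurface m (quadOf κ G H)
  quadOf-on-surface {κ} {G} {H} eq = ℤ.i-j≡0⇒i≡j _ _ (begin
    _                                     ≡⟨ surface-factorisation m c κ G H ⟩
    c * κ * (κ * κ * G₀ - A * A * G * H)  ≡⟨ cong (c * κ *_) (ℤ.i≡j⇒i-j≡0 eq) ⟩
    c * κ * 0ℤ                            ≡⟨ ℤ.*-zeroʳ (c * κ) ⟩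
    0ℤ                                    ∎)

  xᵢ-2x₀ : ∀ κ G H → xᵢ (quadOf κ G H) - + 2 * x₀ (quadOf κ G H) ≡ (1ℤ - c) * (1ℤ - c) * κ
  xᵢ-2x₀ κ _ _ = identity c κ
    where
    identity : ∀ c κ → (1ℤ + c * c) * κ - + 2 * (c * κ) ≡ (1ℤ - c) * (1ℤ - c) * κ
    identity = solve-∀

  1-c≢0 : A ≢ 0ℤ → 1ℤ - c ≢ 0ℤ
  1-c≢0 A≢0 1-c≡0 = A≢0 (trans (factor c) (cong (λ x → - (x * (c + 1ℤ))) 1-c≡0))
    where
    factor : ∀ c → c * c - 1ℤ ≡ - ((1ℤ - c) * (c + 1ℤ))
    factor = solve-∀

-- Local insolubility by descent

module NormForms (p : ℕ) (p-prime : Prime p) where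
  open PrimePowers p p-prime

  -- For c generating the unramified quadratic extension of ℚₚ, the norm form c Z² − W² takes
  -- values of even valuation only; the two fields are the consequences used in the descent.
  record UnramifiedNonsquare (c : ℤ) : Set where
    field
      unit   : Unit c
      c*c≢1  : c * c ≢ 1ℤ
      p∣⇒p²∣ : ∀ W Z → pℤ ∣ c * Z * Z - W * W → p^ 2 ∣ c * Z * Z - W * W
      p³∣⇒p∣ : ∀ W Z → p^ 3 ∣ c * Z * Z - W * W → pℤ ∣ W × pℤ ∣ Z

  p^-odd-step : ∀ k → p^ suc (suc k ℕ.+ suc k) ≡ pℤ * pℤ * p^ suc (k ℕ.+ k)
  p^-odd-step k = begin
    p^ suc (suc k ℕ.+ suc k)   ≡⟨ cong (λ e → p^ suc (suc e)) (ℕ.+-suc k k) ⟩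
    p^ (2 ℕ.+ suc (k ℕ.+ k))   ≡⟨ p^-+ 2 (suc (k ℕ.+ k)) ⟩
    p^ 2 * p^ suc (k ℕ.+ k)    ≡⟨ cong (_* p^ suc (k ℕ.+ k)) p^2≡ ⟩
    pℤ * pℤ * p^ suc (k ℕ.+ k) ∎

  p^3≡ : p^ 3 ≡ pℤ * pℤ * pℤ
  p^3≡ = trans (p^-suc 2) (trans (cong (pℤ *_) p^2≡) (sym (ℤ.*-assoc pℤ pℤ pℤ)))

  p∣⇒p²∣-norm : ∀ c {W Z} → pℤ ∣ W → pℤ ∣ Z → p^ 2 ∣ c * Z * Z - W * W
  p∣⇒p²∣-norm c {W} {Z} p∣W p∣Z = subst (_∣ c * Z * Z - W * W) (sym p^2≡)
    (subst (pℤ * pℤ ∣_) (identity c Z W) (∣m∣n⇒∣m-n (∣n⇒∣m*n c (*-pres-∣ p∣Z p∣Z)) (*-pres-∣ p∣W p∣W)))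
    where
    identity : ∀ c Z W → c * (Z * Z) - W * W ≡ c * Z * Z - W * W
    identity = solve-∀

  module Descent {c : ℤ} (c-nonsquare : UnramifiedNonsquare c) {D′ : ℤ} (D′-unit : Unit D′) where
    open UnramifiedNonsquare c-nonsquare

    form : ℤ → ℤ → ℤ → ℤ → ℤ
    form D W Y Z = c * Z * Z - W * W - c * D * Y * Y

    norm-∣ : ∀ {d} D W Y Z → d ∣ form D W Y Z → d ∣ c * D * Y * Y → d ∣ c * Z * Z - W * W
    norm-∣ D W Y Z d∣form d∣T = subst (_ ∣_) (identity c D W Y Z) (∣m∣n⇒∣m+n d∣form d∣T)
      where
      identity : ∀ c D W Y Z → c * Z * Z - W * W - c * D * Y * Y + c * D * Y * Y ≡ c * Z * Z - W * W
      identity = solve-∀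

    term-∣ : ∀ {d} D W Y Z → d ∣ form D W Y Z → d ∣ c * Z * Z - W * W → d ∣ c * D * Y * Y
    term-∣ D W Y Z d∣form d∣N = subst (_ ∣_) (identity c D W Y Z) (∣m∣n⇒∣m-n d∣N d∣form)
      where
      identity : ∀ c D W Y Z → c * Z * Z - W * W - (c * Z * Z - W * W - c * D * Y * Y) ≡ c * D * Y * Y
      identity = solve-∀

    form-scaleʷᶻ : ∀ D W Y Z → form (pℤ * pℤ * D) (W * pℤ) Y (Z * pℤ) ≡ p^ 2 * form D W Y Z
    form-scaleʷᶻ D W Y Z = trans (identity c D W Y Z pℤ) (cong (_* form D W Y Z) (sym p^2≡))
      where
      identity : ∀ c D W Y Z π → c * (Z * π) * (Z * π) - (W * π) * (W * π) - c * (π * π * D) * Y * Y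
                               ≡ π * π * (c * Z * Z - W * W - c * D * Y * Y)
      identity = solve-∀

    form-scale : ∀ D W Y Z → form D (W * pℤ) (Y * pℤ) (Z * pℤ) ≡ p^ 2 * form D W Y Z
    form-scale D W Y Z = trans (identity c D W Y Z pℤ) (cong (_* form D W Y Z) (sym p^2≡))
      where
      identity : ∀ c D W Y Z π → c * (Z * π) * (Z * π) - (W * π) * (W * π) - c * D * (Y * π) * (Y * π)
                               ≡ π * π * (c * Z * Z - W * W - c * D * Y * Y)
      identity = solve-∀

    Dₖ : ℕ → ℤ
    Dₖ k = p^ suc (k ℕ.+ k) * D′

    threshold : ℕ → ℕ
    threshold k = 3 ℕ.+ (k ℕ.+ k)

    D₀≡ : Dₖ 0 ≡ pℤ * D′
    D₀≡ = cong (_* D′) p^1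

    p∣Y-of-D₀ : ∀ W Y Z → p^ 3 ∣ form (Dₖ 0) W Y Z → pℤ ∣ Y
    p∣Y-of-D₀ W Y Z p³∣form =
      p∣m*m⇒p∣m Y (Unit-cancel-∣ (Y * Y) (Unit-* unit D′-unit)
        (subst (_∣ c * D′ * (Y * Y)) p^1 (p^suc-cancel-∣ 1 p²∣pT)))
      where
      T≡ : c * Dₖ 0 * Y * Y ≡ pℤ * (c * D′ * (Y * Y))
      T≡ = trans (cong (λ D → c * D * Y * Y) D₀≡) (identity c D′ Y pℤ)
        where
        identity : ∀ c D′ Y π → c * (π * D′) * Y * Y ≡ π * (c * D′ * (Y * Y))
        identity = solve-∀
      p²∣N : p^ 2 ∣ c * Z * Z - W * W
      p²∣N = p∣⇒p²∣ W Z (norm-∣ (Dₖ 0) W Y Z (∣-trans (p∣p^ 3 (s≤s z≤n)) p³∣form)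
                                              (subst (pℤ ∣_) (sym T≡) (∣m⇒∣m*n (c * D′ * (Y * Y)) ∣-refl)))
      p²∣pT : p^ 2 ∣ pℤ * (c * D′ * (Y * Y))
      p²∣pT = subst (_ ∣_) T≡
        (term-∣ (Dₖ 0) W Y Z (∣-trans (p^-mono-∣ {2} {3} (s≤s (s≤s z≤n))) p³∣form) p²∣N)

    p³∣T-of-D₀ : ∀ {Y} → pℤ ∣ Y → p^ 3 ∣ c * Dₖ 0 * Y * Y
    p³∣T-of-D₀ {Y} p∣Y =
      subst₂ _∣_ (sym (trans p^3≡ (ℤ.*-assoc pℤ pℤ pℤ)))
                 (sym (trans (cong (λ D → c * D * Y * Y) D₀≡) (identity c D′ Y pℤ)))
                 (*-pres-∣ (∣m⇒∣m*n (c * D′) (∣-refl {pℤ})) (*-pres-∣ p∣Y p∣Y))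
      where
      identity : ∀ c D′ Y π → c * (π * D′) * Y * Y ≡ π * (c * D′) * (Y * Y)
      identity = solve-∀

    3≤odd : ∀ k → 3 ≤ suc (suc k ℕ.+ suc k)
    3≤odd k = s≤s (s≤s (ℕ.≤-trans (s≤s z≤n) (ℕ.m≤n+m (suc k) k)))

    descent-step : ∀ k W Y Z → p^ threshold k ∣ form (Dₖ k) W Y Z → pℤ ∣ W × pℤ ∣ Y × pℤ ∣ Z
    descent-step zero W Y Z p³∣form =
      let p∣Y = p∣Y-of-D₀ W Y Z p³∣form
          (p∣W , p∣Z) = p³∣⇒p∣ W Z (norm-∣ (Dₖ 0) W Y Z p³∣form (p³∣T-of-D₀ p∣Y))
      in  p∣W , p∣Y , p∣Z
    descent-step (suc k) W Y Z p^∣form =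
      let (p∣W , p∣Z) = p³∣⇒p∣ W Z (norm-∣ (Dₖ (suc k)) W Y Z p³∣form p³∣T)
          (_ , p∣Y , _) = descent-step k (quotient p∣W) Y (quotient p∣Z) (reduced p∣W p∣Z)
      in  p∣W , p∣Y , p∣Z
      where
      p³∣form : p^ 3 ∣ form (Dₖ (suc k)) W Y Z
      p³∣form = ∣-trans (p^-mono-∣ (ℕ.m≤m+n 3 (suc k ℕ.+ suc k))) p^∣form
      p³∣T : p^ 3 ∣ c * Dₖ (suc k) * Y * Y
      p³∣T = ∣m⇒∣m*n Y (∣m⇒∣m*n Y (∣n⇒∣m*n c (∣m⇒∣m*n D′ (p^-mono-∣ (3≤odd k)))))
      Dₖ-step : Dₖ (suc k) ≡ pℤ * pℤ * Dₖ k
      Dₖ-step = trans (cong (_* D′) (p^-odd-step k)) (ℤ.*-assoc (pℤ * pℤ) (p^ suc (k ℕ.+ k)) D′)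
      exponent : threshold (suc k) ≡ 2 ℕ.+ threshold k
      exponent = cong (λ e → 4 ℕ.+ e) (ℕ.+-suc k k)
      reduced : (p∣W : pℤ ∣ W) (p∣Z : pℤ ∣ Z) → p^ threshold k ∣ form (Dₖ k) (quotient p∣W) Y (quotient p∣Z)
      reduced (divides W₁ W≡) (divides Z₁ Z≡) =
        p^-cancelˡ-∣ 2 (threshold k) (subst₂ _∣_ (cong p^_ exponent) (begin
          form (Dₖ (suc k)) W Y Z                       ≡⟨ cong₂ (λ W Z → form (Dₖ (suc k)) W Y Z) W≡ Z≡ ⟩
          form (Dₖ (suc k)) (W₁ * pℤ) Y (Z₁ * pℤ)
            ≡⟨ cong (λ D → form D (W₁ * pℤ) Y (Z₁ * pℤ)) Dₖ-step ⟩
          form (pℤ * pℤ * Dₖ k) (W₁ * pℤ) Y (Z₁ * pℤ)   ≡⟨ form-scaleʷᶻ (Dₖ k) W₁ Y Z₁ ⟩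
          p^ 2 * form (Dₖ k) W₁ Y Z₁                    ∎) p^∣form)

    descent : ∀ k j W Y Z → p^ (j ℕ.+ j ℕ.+ threshold k) ∣ form (Dₖ k) W Y Z →
      p^ j ∣ W × p^ j ∣ Y × p^ j ∣ Z
    descent k zero W Y Z _ = 1∣ W , 1∣ Y , 1∣ Z
    descent k (suc j) W Y Z p^∣form =
      let (p∣W , p∣Y , p∣Z) =
            descent-step k W Y Z (∣-trans (p^-mono-∣ (ℕ.m≤n+m (threshold k) (suc j ℕ.+ suc j))) p^∣form)
          (p^j∣W₁ , p^j∣Y₁ , p^j∣Z₁) =
            descent k j (quotient p∣W) (quotient p∣Y) (quotient p∣Z) (reduced p∣W p∣Y p∣Z)
      in  lift p∣W p^j∣W₁ , lift p∣Y p^j∣Y₁ , lift p∣Z p^j∣Z₁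
      where
      lift : ∀ {X} (p∣X : pℤ ∣ X) → p^ j ∣ quotient p∣X → p^ suc j ∣ X
      lift (divides X₁ X≡) p^j∣X₁ = subst (_ ∣_) (sym X≡) (p^∣⇒p^suc∣*p j p^j∣X₁)
      exponent : suc j ℕ.+ suc j ℕ.+ threshold k ≡ 2 ℕ.+ (j ℕ.+ j ℕ.+ threshold k)
      exponent = cong (λ e → suc (e ℕ.+ threshold k)) (ℕ.+-suc j j)
      reduced : (p∣W : pℤ ∣ W) (p∣Y : pℤ ∣ Y) (p∣Z : pℤ ∣ Z) →
        p^ (j ℕ.+ j ℕ.+ threshold k) ∣ form (Dₖ k) (quotient p∣W) (quotient p∣Y) (quotient p∣Z)
      reduced (divides W₁ W≡) (divides Y₁ Y≡) (divides Z₁ Z≡) =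
        p^-cancelˡ-∣ 2 (j ℕ.+ j ℕ.+ threshold k) (subst₂ _∣_ (cong p^_ exponent) (begin
          form (Dₖ k) W Y Z                          ≡⟨ cong₂ (λ W Y → form (Dₖ k) W Y Z) W≡ Y≡ ⟩
          form (Dₖ k) (W₁ * pℤ) (Y₁ * pℤ) Z          ≡⟨ cong (form (Dₖ k) (W₁ * pℤ) (Y₁ * pℤ)) Z≡ ⟩
          form (Dₖ k) (W₁ * pℤ) (Y₁ * pℤ) (Z₁ * pℤ)  ≡⟨ form-scale (Dₖ k) W₁ Y₁ Z₁ ⟩
          p^ 2 * form (Dₖ k) W₁ Y₁ Z₁                ∎) p^∣form)

-- Unramified nonsquares

module Residues (p : ℕ) (p-prime : Prime p) where
  open PrimePowers p p-prime

  instance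
    p-nonZero : ℕ.NonZero p
    p-nonZero = prime⇒nonZero p-prime

  small-unit : ∀ {n} → 0 < n → n < p → Unit (+ n)
  small-unit 0<n n<p p∣n = ℕ.<⇒≱ n<p (ℕ.∣⇒≤ {{ℕ.>-nonZero 0<n}} (∣⇒∣ᵤ p∣n))

  residue : ∀ z → ∃ λ r → r < p × pℤ ∣ z - + r
  residue z = z ℤ.%ℕ p , ℤ.n%ℕd<d z p ,
    divides (z ℤ./ℕ p) (trans (cong (_- + (z ℤ.%ℕ p)) (ℤ.a≡a%ℕn+[a/ℕn]*n z p))
                              (identity (+ (z ℤ.%ℕ p)) ((z ℤ./ℕ p) * pℤ)))
    where
    identity : ∀ r q → r + q - r ≡ q
    identity = solve-∀

  unit-residue : ∀ {z} → Unit z → ∃ λ r → suc r < p × pℤ ∣ z - + suc r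
  unit-residue {z} z-unit with residue z
  ... | zero  , _   , p∣z-0 = contradiction (subst (pℤ ∣_) (ℤ.+-identityʳ z) p∣z-0) z-unit
  ... | suc r , r<p , p∣z-r = r , r<p , p∣z-r

  inverse : ∀ {t} → Unit t → ∃ λ t′ → pℤ ∣ t * t′ - 1ℤ
  inverse {t} t-unit with unit-residue t-unit
  ... | r , r<p , divides k t-r≡ with coprime-Bézout (prime⇒coprime p-prime r<p)
  ...   | ℕ.Bézout.+- x y 1+yr≡xp = - + y , divides (- (k * + y) - + x) (begin
          t * - + y - 1ℤ                               ≡⟨ identity t (+ suc r) (+ y) ⟩
          - ((t - + suc r) * + y) - (1ℤ + + y * + suc r)
            ≡⟨ cong₂ (λ a b → - (a * + y) - b) t-r≡ (integer 1+yr≡xp) ⟩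
          - (k * pℤ * + y) - + x * pℤ                   ≡⟨ identity′ k pℤ (+ y) (+ x) ⟩
          (- (k * + y) - + x) * pℤ                      ∎)
    where
    integer : 1 ℕ.+ y ℕ.* suc r ≡ x ℕ.* p → 1ℤ + + y * + suc r ≡ + x * pℤ
    integer eq = trans (cong (λ z → 1ℤ + z) (sym (ℤ.pos-* y (suc r)))) (trans (sym (ℤ.pos-+ 1 (y ℕ.* suc r)))
                   (trans (cong +_ eq) (ℤ.pos-* x p)))
    identity : ∀ t r y → t * - y - 1ℤ ≡ - ((t - r) * y) - (1ℤ + y * r)
    identity = solve-∀
    identity′ : ∀ k p y x → - (k * p * y) - x * p ≡ (- (k * y) - x) * p
    identity′ = solve-∀
  ...   | ℕ.Bézout.-+ x y 1+xp≡yr = + y , divides (k * + y + + x) (begin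
          t * + y - 1ℤ                                 ≡⟨ identity t (+ suc r) (+ y) ⟩
          (t - + suc r) * + y + (+ y * + suc r - 1ℤ)
            ≡⟨ cong₂ (λ a b → a * + y + (b - 1ℤ)) t-r≡ (sym (integer 1+xp≡yr)) ⟩
          k * pℤ * + y + (1ℤ + + x * pℤ - 1ℤ)           ≡⟨ identity′ k pℤ (+ y) (+ x) ⟩
          (k * + y + + x) * pℤ                          ∎)
    where
    integer : 1 ℕ.+ x ℕ.* p ≡ y ℕ.* suc r → 1ℤ + + x * pℤ ≡ + y * + suc r
    integer eq = trans (cong (λ z → 1ℤ + z) (sym (ℤ.pos-* x p))) (trans (sym (ℤ.pos-+ 1 (x ℕ.* p)))
                   (trans (cong +_ eq) (ℤ.pos-* y (suc r))))
    identity : ∀ t r y → t * y - 1ℤ ≡ (t - r) * y + (y * r - 1ℤ)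
    identity = solve-∀
    identity′ : ∀ k p y x → k * p * y + (1ℤ + x * p - 1ℤ) ≡ (k * y + x) * p
    identity′ = solve-∀

  small-difference-unit : ∀ {m n} → m < n → n < p → Unit (+ n - + m)
  small-difference-unit {m} m<n n<p with ℕ.m≤n⇒∃[o]m+o≡n m<n
  ... | o , refl = subst Unit (sym (trans (cong (λ n → + n - + m) (sym (ℕ.+-suc m o))) (+[m+n]-+m≡+n m (suc o))))
                     (small-unit (s≤s z≤n) (ℕ.≤-<-trans (ℕ.m≤n+m (suc o) m) (subst (_< p) (sym (ℕ.+-suc m o)) n<p)))

module OddPrime (p : ℕ) (p-prime : Prime p) (p≢2 : p ≢ 2) where
  open PrimePowers p p-prime
  open Residues p p-prime
  open NormForms p p-prime

  half : ∃ λ h → p ≡ suc (h ℕ.+ h)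
  half with parity p
  ... | h , inj₂ p≡2h+1 = h , p≡2h+1
  ... | h , inj₁ p≡h+h with prime⇒irreducible p-prime (ℕ.divides h (trans p≡h+h h+h≡h*2))
    where
    h+h≡h*2 : h ℕ.+ h ≡ h ℕ.* 2
    h+h≡h*2 = trans (cong (h ℕ.+_) (sym (ℕ.+-identityʳ h))) (ℕ.*-comm 2 h)
  ...   | inj₁ ()
  ...   | inj₂ 2≡p = contradiction (sym 2≡p) p≢2

  h : ℕ
  h = proj₁ half

  p≡2h+1 : p ≡ suc (h ℕ.+ h)
  p≡2h+1 = proj₂ half

  2h<p : h ℕ.+ h < p
  2h<p = ℕ.≤-reflexive (sym p≡2h+1)

  1≤h : 1 ≤ h
  1≤h with h | p≡2h+1
  ... | zero  | p≡1 = contradiction (sym p≡1) (ℕ.<⇒≢ p>1)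
  ... | suc _ | _   = s≤s z≤n

  sq : Fin h → ℤ
  sq y = + suc (toℕ y) * + suc (toℕ y)

  sq-fromℕ< : ∀ {r} (r<h : r < h) → sq (Fin.fromℕ< r<h) ≡ + suc r * + suc r
  sq-fromℕ< r<h = cong (λ n → + suc n * + suc n) (Fin.toℕ-fromℕ< r<h)

  IsSquare : ℕ → Set
  IsSquare g = ∃ λ (y : Fin h) → pℤ ∣ sq y - + g

  IsSquare? : ∀ g → Dec (IsSquare g)
  IsSquare? g = Fin.any? (λ y → pℤ ∣? sq y - + g)

  difference-of-squares : ∀ a b → pℤ ∣ (a - b) * (a + b) → pℤ ∣ a * a - b * b
  difference-of-squares a b = subst (pℤ ∣_) (identity a b)
    where
    identity : ∀ a b → (a - b) * (a + b) ≡ a * a - b * b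
    identity = solve-∀

  -- Every unit square is, modulo p, the square of one of 1, …, h, since r² ≡ (p − r)².
  square-of-unit : ∀ {z} → Unit z → ∃ λ (y : Fin h) → pℤ ∣ z * z - sq y
  square-of-unit {z} z-unit with unit-residue z-unit
  ... | r′ , r<p , p∣z-r = fold-residue (r ℕ.≤? h)
    where
    r = suc r′
    p∣z²-r² : pℤ ∣ z * z - + r * + r
    p∣z²-r² = difference-of-squares z (+ r) (∣m⇒∣m*n (z + + r) p∣z-r)
    fold-residue : Dec (r ≤ h) → ∃ λ (y : Fin h) → pℤ ∣ z * z - sq y
    fold-residue (yes r≤h) = Fin.fromℕ< r≤h , subst (λ s → pℤ ∣ z * z - s) (sym (sq-fromℕ< r≤h)) p∣z²-r²
    fold-residue (no r≰h) with ℕ.m≤n⇒∃[o]m+o≡n r<p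
    ... | o , r+1+o≡p = Fin.fromℕ< o<h , subst (λ s → pℤ ∣ z * z - s) (sym (sq-fromℕ< o<h))
                          (subst (pℤ ∣_) (identity z (+ r) (+ suc o)) (∣m∣n⇒∣m+n p∣z²-r² p∣r²-s²))
      where
      o<h : o < h
      o<h = ℕ.+-cancelˡ-≤ h (suc o) h (ℕ.≤-pred (ℕ.≤-trans (ℕ.+-monoˡ-≤ (suc o) (ℕ.≰⇒> r≰h))
                                                          (ℕ.≤-reflexive (trans (ℕ.+-suc r o) (trans r+1+o≡p p≡2h+1)))))
      r+s≡p : + r + + suc o ≡ pℤ
      r+s≡p = trans (sym (ℤ.pos-+ r (suc o))) (cong +_ (trans (ℕ.+-suc r o) r+1+o≡p))
      p∣r²-s² : pℤ ∣ + r * + r - + suc o * + suc o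
      p∣r²-s² = difference-of-squares (+ r) (+ suc o)
        (subst (λ x → pℤ ∣ (+ r - + suc o) * x) (sym r+s≡p) (∣n⇒∣m*n (+ r - + suc o) ∣-refl))
      identity : ∀ z r s → z * z - r * r + (r * r - s * s) ≡ z * z - s * s
      identity = solve-∀

  not-all-squares : ¬ (∀ (g : Fin (h ℕ.+ h)) → IsSquare (suc (toℕ g)))
  not-all-squares all-squares =
    let (i , j , i<j , same-root) = Fin.pigeonhole (ℕ.m<m+n h 1≤h) (proj₁ ∘ all-squares)
    in  small-difference-unit (s≤s i<j) (ℕ.≤-<-trans (Fin.toℕ<n j) 2h<p)
          (subst (pℤ ∣_) (identity (sq (proj₁ (all-squares j))) (+ suc (toℕ i)) (+ suc (toℕ j)))
            (∣m∣n⇒∣m-n (subst (λ y → pℤ ∣ sq y - + suc (toℕ i)) same-root (proj₂ (all-squares i)))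
                       (proj₂ (all-squares j))))
    where
    identity : ∀ s a b → s - a - (s - b) ≡ b - a
    identity = solve-∀

  nonsquare : ∃ λ g → 2 ≤ g × g < p × ¬ IsSquare g
  nonsquare =
    let (g , g-nonsquare) = Fin.¬∀⟶∃¬ (h ℕ.+ h) (IsSquare ∘ suc ∘ toℕ) (IsSquare? ∘ suc ∘ toℕ) not-all-squares
    in  suc (toℕ g) , 2≤ (toℕ g) g-nonsquare , ℕ.≤-<-trans (Fin.toℕ<n g) 2h<p , g-nonsquare
    where
    2≤ : ∀ n → ¬ IsSquare (suc n) → 2 ≤ suc n
    2≤ zero    ¬square =
      contradiction (Fin.fromℕ< 1≤h , subst (λ s → pℤ ∣ s - 1ℤ) (sym (sq-fromℕ< 1≤h)) (pℤ ∣0)) ¬square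
    2≤ (suc n) _       = s≤s (s≤s z≤n)

  nonsquare⇒p∣ : ∀ {g} → ¬ IsSquare g → Unit (+ g) → ∀ s t → pℤ ∣ s * s - + g * t * t → pℤ ∣ t
  nonsquare⇒p∣ {g} ¬square g-unit s t p∣s²-gt² = decidable-stable (pℤ ∣? t) λ t-unit →
    let (t′ , p∣tt′-1) = inverse t-unit
        u = s * t′
        p∣u²-g : pℤ ∣ u * u - + g
        p∣u²-g = subst (pℤ ∣_) (identity s t t′ (+ g))
                   (∣m∣n⇒∣m+n (∣n⇒∣m*n (t′ * t′) p∣s²-gt²)
                              (∣n⇒∣m*n (+ g) (∣m⇒∣m*n (t * t′ + 1ℤ) p∣tt′-1)))
        u-unit : Unit u
        u-unit p∣u = g-unit (subst (pℤ ∣_) (identity′ u (+ g)) (∣m∣n⇒∣m-n (∣m⇒∣m*n u p∣u) p∣u²-g))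
        (y , p∣u²-y²) = square-of-unit u-unit
    in  ¬square (y , subst (pℤ ∣_) (identity″ u (sq y) (+ g)) (∣m∣n⇒∣m-n p∣u²-g p∣u²-y²))
    where
    identity : ∀ s t t′ g → t′ * t′ * (s * s - g * t * t) + g * ((t * t′ - 1ℤ) * (t * t′ + 1ℤ))
                          ≡ s * t′ * (s * t′) - g
    identity = solve-∀
    identity′ : ∀ u g → u * u - (u * u - g) ≡ g
    identity′ = solve-∀
    identity″ : ∀ u y² g → u * u - g - (u * u - y²) ≡ y² - g
    identity″ = solve-∀

  unramified-of-nonsquare : ∀ {g} → 2 ≤ g → g < p → ¬ IsSquare g → UnramifiedNonsquare (+ g)
  unramified-of-nonsquare {g} 2≤g g<p ¬square = record
    { unit   = g-unit
    ; c*c≢1  = λ g²≡1 → ℕ.<⇒≢ 2≤g (sym (ℕ.m*n≡1⇒m≡1 g g (ℤ.+-injective (trans (ℤ.pos-* g g) g²≡1))))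
    ; p∣⇒p²∣ = λ W Z p∣N → let (p∣W , p∣Z) = p∣W,Z W Z p∣N in p∣⇒p²∣-norm (+ g) p∣W p∣Z
    ; p³∣⇒p∣ = λ W Z p³∣N → p∣W,Z W Z (∣-trans (p∣p^ 3 (s≤s z≤n)) p³∣N) }
    where
    g-unit : Unit (+ g)
    g-unit = small-unit (ℕ.≤-trans (s≤s z≤n) 2≤g) g<p
    p∣W,Z : ∀ W Z → pℤ ∣ + g * Z * Z - W * W → pℤ ∣ W × pℤ ∣ Z
    p∣W,Z W Z p∣N =
      p∣m*m⇒p∣m W (subst (pℤ ∣_) (identity′ (+ g) W Z) (∣m∣n⇒∣m-n (∣n⇒∣m*n (+ g * Z) p∣Z) p∣N)) , p∣Z
      where
      identity : ∀ g W Z → - (g * Z * Z - W * W) ≡ W * W - g * Z * Z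
      identity = solve-∀
      identity′ : ∀ g W Z → g * Z * Z - (g * Z * Z - W * W) ≡ W * W
      identity′ = solve-∀
      p∣Z : pℤ ∣ Z
      p∣Z = nonsquare⇒p∣ ¬square g-unit W Z (subst (pℤ ∣_) (identity (+ g) W Z) (∣m⇒∣-m p∣N))

  nonsquare-unramified : ∃ UnramifiedNonsquare
  nonsquare-unramified =
    let (g , 2≤g , g<p , ¬square) = nonsquare in + g , unramified-of-nonsquare 2≤g g<p ¬square

module Two (two-prime : Prime 2) where
  open PrimePowers 2 two-prime
  open Residues 2 two-prime
  open NormForms 2 two-prime

  odd-form : ∀ {x} → Unit x → ∃ λ k → x ≡ 1ℤ + + 2 * k
  odd-form {x} x-unit with unit-residue x-unit
  ... | zero  , _ , divides k x-1≡ = k , trans (identity x) (cong (λ y → 1ℤ + y) (trans x-1≡ (ℤ.*-comm k (+ 2))))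
    where
    identity : ∀ x → x ≡ 1ℤ + (x - 1ℤ)
    identity = solve-∀
  ... | suc _ , s≤s (s≤s ()) , _

  2∣k*[k+1] : ∀ k → pℤ ∣ k * (k + 1ℤ)
  2∣k*[k+1] k = by-parity (pℤ ∣? k)
    where
    by-parity : Dec (pℤ ∣ k) → pℤ ∣ k * (k + 1ℤ)
    by-parity (yes 2∣k)    = ∣m⇒∣m*n (k + 1ℤ) 2∣k
    by-parity (no k-unit) =
      let (j , k≡) = odd-form k-unit
      in  ∣n⇒∣m*n k (divides (1ℤ + j) (trans (cong (_+ 1ℤ) k≡) (identity j)))
      where
      identity : ∀ j → 1ℤ + + 2 * j + 1ℤ ≡ (1ℤ + j) * + 2
      identity = solve-∀

  odd-square : ∀ {x} → Unit x → + 8 ∣ x * x - 1ℤ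
  odd-square x-unit with odd-form x-unit
  ... | k , refl = subst (+ 8 ∣_) (sym (identity k)) (*-monoʳ-∣ (+ 4) (2∣k*[k+1] k))
    where
    identity : ∀ k → (1ℤ + + 2 * k) * (1ℤ + + 2 * k) - 1ℤ ≡ + 4 * (k * (k + 1ℤ))
    identity = solve-∀

  five-unit : Unit (+ 5)
  five-unit = Unit-1+ {+ 4} (divides (+ 2) refl)

  parities-agree : ∀ W Z → pℤ ∣ + 5 * Z * Z - W * W → (pℤ ∣ W × pℤ ∣ Z) ⊎ (Unit W × Unit Z)
  parities-agree W Z p∣N = by-parity (pℤ ∣? W)
    where
    identity : ∀ W Z → + 5 * Z * Z - W * W + W * W ≡ + 5 * (Z * Z)
    identity = solve-∀
    p∣5Z² : pℤ ∣ W * W → pℤ ∣ + 5 * (Z * Z)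
    p∣5Z² p∣W² = subst (pℤ ∣_) (identity W Z) (∣m∣n⇒∣m+n p∣N p∣W²)
    p∣Z-of : pℤ ∣ W → pℤ ∣ Z
    p∣Z-of p∣W = p∣m*m⇒p∣m Z (Unit-cancel-∣ (Z * Z) five-unit (p∣5Z² (∣m⇒∣m*n W p∣W)))
    by-parity : Dec (pℤ ∣ W) → (pℤ ∣ W × pℤ ∣ Z) ⊎ (Unit W × Unit Z)
    by-parity (yes p∣W)   = inj₁ (p∣W , p∣Z-of p∣W)
    by-parity (no W-unit) = inj₂ (W-unit , λ p∣Z → W-unit (p∣m*m⇒p∣m W (∣m+n∣m⇒∣n
      (subst (pℤ ∣_) (sym (identity W Z)) (∣n⇒∣m*n (+ 5) (∣m⇒∣m*n Z p∣Z))) p∣N)))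

  odd-norm : ∀ {W Z} → Unit W → Unit Z → + 5 * Z * Z - W * W ≡ + 5 * (Z * Z - 1ℤ) - (W * W - 1ℤ) + + 4
  odd-norm {W} {Z} _ _ = identity W Z
    where
    identity : ∀ W Z → + 5 * Z * Z - W * W ≡ + 5 * (Z * Z - 1ℤ) - (W * W - 1ℤ) + + 4
    identity = solve-∀

  five-unramified : UnramifiedNonsquare (+ 5)
  five-unramified = record
    { unit   = five-unit
    ; c*c≢1  = λ ()
    ; p∣⇒p²∣ = λ W Z p∣N → p²∣N (parities-agree W Z p∣N)
    ; p³∣⇒p∣ = λ W Z p³∣N → p∣W,Z p³∣N (parities-agree W Z (∣-trans (p∣p^ 3 (s≤s z≤n)) p³∣N)) }
    where
    4∣8 : + 4 ∣ + 8
    4∣8 = divides (+ 2) refl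
    8∤4 : ¬ + 8 ∣ + 4
    8∤4 8∣4 = ℕ.<⇒≱ (from-yes (4 ℕ.<? 8)) (ℕ.∣⇒≤ (∣⇒∣ᵤ {+ 8} {+ 4} 8∣4))
    p²∣N : ∀ {W Z} → (pℤ ∣ W × pℤ ∣ Z) ⊎ (Unit W × Unit Z) → p^ 2 ∣ + 5 * Z * Z - W * W
    p²∣N (inj₁ (p∣W , p∣Z))      = p∣⇒p²∣-norm (+ 5) p∣W p∣Z
    p²∣N (inj₂ (W-unit , Z-unit)) = subst (+ 4 ∣_) (sym (odd-norm W-unit Z-unit))
      (∣m∣n⇒∣m+n (∣m∣n⇒∣m-n (∣n⇒∣m*n (+ 5) (∣-trans 4∣8 (odd-square Z-unit)))
                            (∣-trans 4∣8 (odd-square W-unit)))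
                 ∣-refl)
    p∣W,Z : ∀ {W Z} → p^ 3 ∣ + 5 * Z * Z - W * W → (pℤ ∣ W × pℤ ∣ Z) ⊎ (Unit W × Unit Z) →
      pℤ ∣ W × pℤ ∣ Z
    p∣W,Z _ (inj₁ p∣W,Z) = p∣W,Z
    p∣W,Z {W} {Z} 8∣N (inj₂ (W-unit , Z-unit)) = contradiction
      (subst (+ 8 ∣_) (four (odd-norm W-unit Z-unit))
        (∣m∣n⇒∣m+n (∣m∣n⇒∣m-n 8∣N (∣n⇒∣m*n (+ 5) (odd-square Z-unit))) (odd-square W-unit)))
      8∤4
      where
      four : ∀ {N a b} → N ≡ + 5 * a - b + + 4 → N - + 5 * a + b ≡ + 4
      four {a = a} {b} refl = identity a b
        where
        identity : ∀ a b → + 5 * a - b + + 4 - + 5 * a + b ≡ + 4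
        identity = solve-∀

∃-unramified-nonsquare : ∀ p (p-prime : Prime p) → ∃ (NormForms.UnramifiedNonsquare p p-prime)
∃-unramified-nonsquare p p-prime with p ℕ.≟ 2
... | yes refl = + 5 , Two.five-unramified p-prime
... | no p≢2   = OddPrime.nonsquare-unramified p p-prime p≢2

-- The two points

∃-unit-q⁴-1≡p^a*unit : ∀ p (p-prime : Prime p) a → 4 ≤ a → let open PrimePowers p p-prime in
  ∃₂ λ q A′ → q * q * (q * q) - 1ℤ ≡ p^ a * A′ × Unit q × Unit A′
∃-unit-q⁴-1≡p^a*unit p p-prime a 4≤a with p ℕ.≟ 2
... | no p≢2 = 1ℤ + ρ , A′ , identity ρ , Unit-1+ p∣ρ ,
               Unit-≡-mod-p 4-unit (subst (pℤ ∣_) (sym (A′-4 ρ)) (∣m⇒∣m*n (+ 6 + + 4 * ρ + ρ * ρ) p∣ρ))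
  where
  open PrimePowers p p-prime
  ρ A′ : ℤ
  ρ  = p^ a
  A′ = (+ 2 + ρ) * (+ 2 + + 2 * ρ + ρ * ρ)
  p∣ρ : pℤ ∣ ρ
  p∣ρ = p∣p^ a (ℕ.≤-trans (s≤s z≤n) 4≤a)
  identity : ∀ ρ → (1ℤ + ρ) * (1ℤ + ρ) * ((1ℤ + ρ) * (1ℤ + ρ)) - 1ℤ
                 ≡ ρ * ((+ 2 + ρ) * (+ 2 + + 2 * ρ + ρ * ρ))
  identity = solve-∀
  A′-4 : ∀ ρ → (+ 2 + ρ) * (+ 2 + + 2 * ρ + ρ * ρ) - + 4 ≡ ρ * (+ 6 + + 4 * ρ + ρ * ρ)
  A′-4 = solve-∀
  4-unit : Unit (+ 4)
  4-unit p∣4 = p≢2 (p∣2⇒p≡2 (p∣m*m⇒p∣m (+ 2) p∣4))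
... | yes refl with ℕ.m≤n⇒∃[o]m+o≡n 4≤a
...   | o , refl = 1ℤ + + 2 * σ , A′ , q⁴-1≡ , Unit-1+ (∣m⇒∣m*n σ ∣-refl) ,
                   Unit-* (Unit-1+ p∣σ) (Unit-1+ (∣m⇒∣m*n (σ * (1ℤ + σ)) ∣-refl))
  where
  open PrimePowers 2 p-prime
  σ A′ : ℤ
  σ  = p^ suc o
  A′ = (1ℤ + σ) * (1ℤ + + 2 * (σ * (1ℤ + σ)))
  p∣σ : pℤ ∣ σ
  p∣σ = p∣p^ (suc o) (s≤s z≤n)
  identity : ∀ σ → (1ℤ + + 2 * σ) * (1ℤ + + 2 * σ) * ((1ℤ + + 2 * σ) * (1ℤ + + 2 * σ)) - 1ℤ
                 ≡ σ * + 8 * ((1ℤ + σ) * (1ℤ + + 2 * (σ * (1ℤ + σ))))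
  identity = solve-∀
  q⁴-1≡ : (1ℤ + + 2 * σ) * (1ℤ + + 2 * σ) * ((1ℤ + + 2 * σ) * (1ℤ + + 2 * σ)) - 1ℤ ≡ p^ (4 ℕ.+ o) * A′
  q⁴-1≡ = trans (identity σ) (cong (_* A′) (trans (sym (p^-+ (suc o) 3)) (cong p^_ (ℕ.+-comm (suc o) 3))))

module Construction (p : ℕ) (p-prime : Prime p) (m : ℤ) where
  open PrimePowers p p-prime
  open Points p p-prime m
  open NormForms p p-prime

  module FamilyPoint {c : ℤ} (c-unit : Unit c) (κ G H : ℤ)
    (on : κ * κ * Family.G₀ m c ≡ Family.A m c * Family.A m c * G * H) (G-unit : Unit G) (p∣H : pℤ ∣ H) where
    open Family m c

    xⱼ-unit : Unit (c * (G + H))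
    xⱼ-unit = Unit-* c-unit (Unit-≡-mod-p G-unit (subst (pℤ ∣_) (sym (identity G H)) p∣H))
      where
      identity : ∀ G H → G + H - G ≡ H
      identity = solve-∀

    xₖ-unit : Unit (c * c * G + H)
    xₖ-unit = Unit-≡-mod-p (Unit-* (Unit-* c-unit c-unit) G-unit) (subst (pℤ ∣_) (sym (identity (c * c * G) H)) p∣H)
      where
      identity : ∀ G H → G + H - G ≡ H
      identity = solve-∀

    familyPoint : Fin 3 → Point p m
    familyPoint i = point i (quadOf κ G H) (quadOf-on-surface on) xⱼ-unit

    familyPoint-str : ∀ k ω i {w} → ω i ≡ just w → ∀ ν {u} → κ ≡ p^ ν * u → Unit u → Allowed k w ν →
      StrPoint k ω (familyPoint i)
    familyPoint-str k ω i ωᵢ≡w ν {u} κ≡ u-unit =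
      point-str i (quadOf κ G H) _ xⱼ-unit xₖ-unit k ω ωᵢ≡w ν
        (trans (cong (c *_) κ≡) (identity c (p^ ν) u)) (Unit-* c-unit u-unit)
        (subst (p^ ν ∣_) (sym (cong ((1ℤ + c * c) *_) κ≡)) (∣n⇒∣m*n (1ℤ + c * c) (p^∣p^* ν u)))
      where
      identity : ∀ c π u → c * (π * u) ≡ π * (c * u)
      identity = solve-∀

  -- The unscaled parameters (ℓ A, G₀, ℓ²), ℓ = − A D, divided by p^d = p^v(D); as 2a > d,
  -- G is a unit and x₀ has valuation 2a.
  module TrivialSymbols {d : ℕ} {D′ : ℤ} (m-4≡ : m - + 4 ≡ p^ d * D′) (D′-unit : Unit D′)
    {q A′ : ℤ} {a : ℕ} (q⁴-1≡ : q * q * (q * q) - 1ℤ ≡ p^ a * A′) (q-unit : Unit q) (A′-unit : Unit A′)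
    {t : ℕ} (a+a≡ : a ℕ.+ a ≡ d ℕ.+ suc t) where

    c : ℤ
    c = q * q

    open Family m c

    c-unit : Unit c
    c-unit = Unit-* q-unit q-unit

    κ G H ℓ : ℤ
    κ = - (A * A * D′)
    G = p^ suc t * A′ * A′ - c * c * D′
    H = A * A * D * D′
    ℓ = - (A * D)

    A*A≡ : A * A ≡ p^ d * (p^ suc t * A′ * A′)
    A*A≡ = begin
      A * A                           ≡⟨ cong₂ _*_ q⁴-1≡ q⁴-1≡ ⟩
      p^ a * A′ * (p^ a * A′)         ≡⟨ identity (p^ a) A′ ⟩
      p^ a * p^ a * (A′ * A′)         ≡⟨ cong (_* (A′ * A′)) (sym (p^-+ a a)) ⟩
      p^ (a ℕ.+ a) * (A′ * A′)        ≡⟨ cong (λ e → p^ e * (A′ * A′)) a+a≡ ⟩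
      p^ (d ℕ.+ suc t) * (A′ * A′)    ≡⟨ cong (_* (A′ * A′)) (p^-+ d (suc t)) ⟩
      p^ d * p^ suc t * (A′ * A′)     ≡⟨ identity′ (p^ d) (p^ suc t) A′ ⟩
      p^ d * (p^ suc t * A′ * A′)     ∎
      where
      identity : ∀ π A′ → π * A′ * (π * A′) ≡ π * π * (A′ * A′)
      identity = solve-∀
      identity′ : ∀ δ π A′ → δ * π * (A′ * A′) ≡ δ * (π * A′ * A′)
      identity′ = solve-∀

    scaled-G : p^ d * G ≡ G₀
    scaled-G = begin
      p^ d * G                                         ≡⟨ identity (p^ d) (p^ suc t * A′ * A′) c D′ ⟩
      p^ d * (p^ suc t * A′ * A′) - c * c * (p^ d * D′) ≡⟨ cong₂ (λ x y → x - c * c * y) (sym A*A≡) (sym m-4≡) ⟩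
      G₀                                               ∎
      where
      identity : ∀ δ B c D′ → δ * (B - c * c * D′) ≡ δ * B - c * c * (δ * D′)
      identity = solve-∀

    scaled-κ : p^ d * κ ≡ ℓ * A
    scaled-κ = trans (identity (p^ d) A D′) (cong (λ D → - (A * D) * A) (sym m-4≡))
      where
      identity : ∀ δ A D′ → δ * - (A * A * D′) ≡ - (A * (δ * D′)) * A
      identity = solve-∀

    scaled-H : p^ d * H ≡ ℓ * ℓ
    scaled-H = trans (identity (p^ d) A D D′) (cong (λ D′′ → - (A * D) * - (A * D′′)) (sym m-4≡))
      where
      identity : ∀ δ A D D′ → δ * (A * A * D * D′) ≡ - (A * D) * - (A * (δ * D′))
      identity = solve-∀

    on-surface : κ * κ * G₀ ≡ A * A * G * H
    on-surface = begin
      κ * κ * G₀                             ≡⟨ cong (κ * κ *_) scaled-G ⟨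
      κ * κ * (p^ d * G)                     ≡⟨ identity A D′ (p^ d) G ⟩
      A * A * G * (A * A * (p^ d * D′) * D′) ≡⟨ cong (λ D → A * A * G * (A * A * D * D′)) m-4≡ ⟨
      A * A * G * H                          ∎
      where
      identity : ∀ A D′ δ G → - (A * A * D′) * - (A * A * D′) * (δ * G) ≡ A * A * G * (A * A * (δ * D′) * D′)
      identity = solve-∀

    A≢0 : A ≢ 0ℤ
    A≢0 = subst (_≢ 0ℤ) (sym q⁴-1≡) (p^*unit≢0 a A′-unit)

    1≤a : 1 ≤ a
    1≤a = positive a a+a≡
      where
      positive : ∀ a → a ℕ.+ a ≡ d ℕ.+ suc t → 1 ≤ a
      positive zero    0≡d+1+t = contradiction (trans 0≡d+1+t (ℕ.+-suc d t)) λ ()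
      positive (suc _) _       = s≤s z≤n

    p∣A : pℤ ∣ A
    p∣A = subst (pℤ ∣_) (sym q⁴-1≡) (∣m⇒∣m*n A′ (p∣p^ a 1≤a))

    u : ℤ
    u = - (A′ * A′ * D′)

    u-unit : Unit u
    u-unit = Unit-neg (Unit-* (Unit-* A′-unit A′-unit) D′-unit)

    κ≡ : κ ≡ p^ (a ℕ.+ a) * u
    κ≡ = begin
      - (A * A * D′)                  ≡⟨ cong (λ A → - (A * A * D′)) q⁴-1≡ ⟩
      - (p^ a * A′ * (p^ a * A′) * D′) ≡⟨ identity (p^ a) A′ D′ ⟩
      p^ a * p^ a * u                 ≡⟨ cong (_* u) (p^-+ a a) ⟨
      p^ (a ℕ.+ a) * u                ∎
      where
      identity : ∀ π A′ D′ → - (π * A′ * (π * A′) * D′) ≡ π * π * - (A′ * A′ * D′)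
      identity = solve-∀

    κ≢0 : κ ≢ 0ℤ
    κ≢0 = subst (_≢ 0ℤ) (sym κ≡) (p^*unit≢0 (a ℕ.+ a) u-unit)

    G-unit : Unit G
    G-unit = Unit-≡-mod-p (Unit-neg (Unit-* (Unit-* c-unit c-unit) D′-unit))
      (subst (pℤ ∣_) (sym (identity (p^ suc t) A′ c D′))
        (∣m⇒∣m*n A′ (∣m⇒∣m*n A′ (p∣p^ (suc t) (s≤s z≤n)))))
      where
      identity : ∀ π A′ c D′ → π * A′ * A′ - c * c * D′ - - (c * c * D′) ≡ π * A′ * A′
      identity = solve-∀

    p∣H : pℤ ∣ H
    p∣H = ∣m⇒∣m*n D′ (∣m⇒∣m*n D (∣m⇒∣m*n A p∣A))

    open FamilyPoint c-unit κ G H on-surface G-unit p∣H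

    Q : Quad
    Q = quadOf κ G H

    x₀≢0 : x₀ Q ≢ 0ℤ
    x₀≢0 = *-≢0 (Unit⇒≢0 c-unit) κ≢0

    p∣x₀ : pℤ ∣ x₀ Q
    p∣x₀ = ∣n⇒∣m*n c (subst (pℤ ∣_) (sym κ≡) (∣m⇒∣m*n u (p∣p^ (a ℕ.+ a) (ℕ.≤-trans 1≤a (ℕ.m≤m+n a a)))))

    -2x₀-unit : ∀ {v} → Unit v → Unit (v - + 2 * x₀ Q)
    -2x₀-unit {v} v-unit =
      Unit-≡-mod-p v-unit (subst (pℤ ∣_) (sym (identity v (x₀ Q))) (∣m⇒∣-m (∣n⇒∣m*n (+ 2) p∣x₀)))
      where
      identity : ∀ v x → v - + 2 * x - v ≡ - (+ 2 * x)
      identity = solve-∀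

    scaled-x₀ : p^ d * x₀ Q ≡ c * (ℓ * A)
    scaled-x₀ = trans (identity (p^ d) c κ) (cong (c *_) scaled-κ)
      where
      identity : ∀ δ c κ → δ * (c * κ) ≡ c * (δ * κ)
      identity = solve-∀

    trivialᵢ : TrivialSymbol Q (xᵢ Q)
    trivialᵢ = subst (_≢ 0ℤ) (sym (xᵢ-2x₀ κ G H)) (*-≢0 (*-≢0 (1-c≢0 A≢0) (1-c≢0 A≢0)) κ≢0) ,
               q , 0ℤ , 1ℤ - c , Unit⇒≢0 q-unit , identity q κ D
      where
      identity : ∀ q κ D → q * q * κ * (1ℤ - q * q) * (1ℤ - q * q)
                         ≡ ((1ℤ + q * q * (q * q)) * κ - + 2 * (q * q * κ)) * q * q + q * q * κ * D * 0ℤ * 0ℤ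
      identity = solve-∀

    trivialⱼ : TrivialSymbol Q (xⱼ Q)
    trivialⱼ = Unit⇒≢0 (-2x₀-unit xⱼ-unit) ,
               c * (ℓ * A) , Y , Z , subst (_≢ 0ℤ) scaled-x₀ (*-≢0 (p^≢0 d) x₀≢0) ,
               hilbert-of-norm D Y Z (p^≢0 d) scaled-x₀ scaled-xⱼ (norm-at-xⱼ c A D)
      where
      Y Z : ℤ
      Y = c * A * A * (1ℤ + D)
      Z = c * c * A * D
      scaled-xⱼ : p^ d * xⱼ Q ≡ c * (G₀ + ℓ * ℓ)
      scaled-xⱼ = trans (identity (p^ d) c G H) (cong (c *_) (cong₂ _+_ scaled-G scaled-H))
        where
        identity : ∀ δ c G H → δ * (c * (G + H)) ≡ c * (δ * G + δ * H)
        identity = solve-∀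

    trivialₖ : TrivialSymbol Q (xₖ Q)
    trivialₖ = Unit⇒≢0 (-2x₀-unit xₖ-unit) ,
               c * (ℓ * A) , Y , Z , subst (_≢ 0ℤ) scaled-x₀ (*-≢0 (p^≢0 d) x₀≢0) ,
               hilbert-of-norm D Y Z (p^≢0 d) scaled-x₀ scaled-xₖ (norm-at-xₖ q A D)
      where
      Y Z : ℤ
      Y = q * A * A * (c + D)
      Z = q * c * c * A * D
      scaled-xₖ : p^ d * xₖ Q ≡ c * c * G₀ + ℓ * ℓ
      scaled-xₖ = trans (identity (p^ d) c G H) (cong₂ (λ x y → c * c * x + y) scaled-G scaled-H)
        where
        identity : ∀ δ c G H → δ * (c * c * G + H) ≡ c * c * (δ * G) + δ * H
        identity = solve-∀

    symbol-point : ∀ k ω i {w} → ω i ≡ just w → Allowed k w (a ℕ.+ a) →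
      ∃ λ (M : Point p m) → StrPoint k ω M × (∀ l → Inv0 M l)
    symbol-point k ω i ωᵢ≡w allowed =
      familyPoint i ,
      familyPoint-str k ω i ωᵢ≡w (a ℕ.+ a) κ≡ u-unit allowed ,
      Inv0-of i Q (quadOf-on-surface on-surface) xⱼ-unit trivialᵢ trivialⱼ trivialₖ

  trivial-symbols-point : ∀ {d D′} → m - + 4 ≡ p^ d * D′ → Unit D′ → ∀ k ω i {w} → ω i ≡ just w → 2 ≤ w →
    ∃ λ (M : Point p m) → StrPoint k ω M × (∀ l → Inv0 M l)
  trivial-symbols-point {d} m-4≡ D′-unit k ω i {w} ωᵢ≡w 2≤w =
    let (q , A′ , q⁴-1≡ , q-unit , A′-unit) = ∃-unit-q⁴-1≡p^a*unit p p-prime a 4≤a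
        (t , d+1+t≡a+a) = ℕ.m≤n⇒∃[o]m+o≡n d<a+a
    in  TrivialSymbols.symbol-point {d = d} m-4≡ D′-unit {a = a} q⁴-1≡ q-unit A′-unit
          (trans (sym d+1+t≡a+a) (sym (ℕ.+-suc d t))) k ω i ωᵢ≡w allowed
    where
    a : ℕ
    a = w ℕ.* (2 ℕ.+ d)
    4≤a : 4 ≤ a
    4≤a = ℕ.*-mono-≤ 2≤w (s≤s (s≤s z≤n))
    d<a+a : d ℕ.< a ℕ.+ a
    d<a+a = ℕ.≤-trans (ℕ.n≤1+n (suc d))
              (ℕ.≤-trans (ℕ.m≤n*m (2 ℕ.+ d) w {{ℕ.>-nonZero (ℕ.≤-trans (s≤s z≤n) 2≤w)}}) (ℕ.m≤m+n a a))
    allowed : Allowed k w (a ℕ.+ a)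
    allowed = subst (Allowed k w) (ℕ.*-distribˡ-+ w (2 ℕ.+ d) (2 ℕ.+ d)) (allowed-multiple k w (suc d ℕ.+ (2 ℕ.+ d)))

  module NontrivialSymbol {k₀ : ℕ} {D′ : ℤ} (m-4≡ : m - + 4 ≡ p^ suc (k₀ ℕ.+ k₀) * D′) (D′-unit : Unit D′)
    {c : ℤ} (c-nonsquare : UnramifiedNonsquare c) (w′ : ℕ) where
    open Family m c
    open UnramifiedNonsquare c-nonsquare using (unit; c*c≢1)
    open Descent c-nonsquare D′-unit

    A≢0 : A ≢ 0ℤ
    A≢0 A≡0 = c*c≢1 (ℤ.i-j≡0⇒i≡j (c * c) 1ℤ A≡0)

    open Valuation (valuation A≢0) using () renaming (ν to a; u to A′; z≡p^ν*u to A≡; u-unit to A′-unit)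
    open Valuation (valuation (1-c≢0 A≢0)) using () renaming (ν to σ; u to s′; z≡p^ν*u to 1-c≡; u-unit to s′-unit)

    G₀≢0 : G₀ ≢ 0ℤ
    G₀≢0 G₀≡0 = even≢odd a k₀ (p^*unit-injective (Unit-* A′-unit A′-unit) (Unit-* (Unit-* unit unit) D′-unit) (begin
      p^ (a ℕ.+ a) * (A′ * A′)            ≡⟨ cong (_* (A′ * A′)) (p^-+ a a) ⟩
      p^ a * p^ a * (A′ * A′)             ≡⟨ identity (p^ a) A′ ⟩
      p^ a * A′ * (p^ a * A′)             ≡⟨ cong₂ _*_ A≡ A≡ ⟨
      A * A                               ≡⟨ ℤ.i-j≡0⇒i≡j (A * A) (c * c * D) G₀≡0 ⟩
      c * c * D                           ≡⟨ cong (c * c *_) m-4≡ ⟩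
      c * c * (p^ suc (k₀ ℕ.+ k₀) * D′)   ≡⟨ identity′ c (p^ suc (k₀ ℕ.+ k₀)) D′ ⟩
      p^ suc (k₀ ℕ.+ k₀) * (c * c * D′)   ∎))
      where
      identity : ∀ π A′ → π * π * (A′ * A′) ≡ π * A′ * (π * A′)
      identity = solve-∀
      identity′ : ∀ c π D′ → c * c * (π * D′) ≡ π * (c * c * D′)
      identity′ = solve-∀

    open Valuation (valuation G₀≢0) using () renaming (ν to e; u to G; z≡p^ν*u to G₀≡; u-unit to G-unit)

    -- Given G₀ = p^e G, the choice κ = p^ν A′, H = p^h solves κ² G₀ = A² G H iff 2ν + e = 2a + h.
    r ν h : ℕ
    r = w′ ℕ.* suc a
    ν = a ℕ.+ suc r
    h = suc r ℕ.+ suc r ℕ.+ e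

    κ H : ℤ
    κ = p^ ν * A′
    H = p^ h

    on-surface : κ * κ * G₀ ≡ A * A * G * H
    on-surface = begin
      κ * κ * G₀                          ≡⟨ cong (κ * κ *_) G₀≡ ⟩
      p^ ν * A′ * (p^ ν * A′) * (p^ e * G) ≡⟨ identity (p^ ν) (p^ ν) (p^ e) A′ G ⟩
      p^ ν * p^ ν * p^ e * (A′ * A′ * G)  ≡⟨ cong (_* (A′ * A′ * G)) exponents ⟩
      p^ a * p^ a * p^ h * (A′ * A′ * G)  ≡⟨ identity′ (p^ a) (p^ a) (p^ h) A′ G ⟩
      p^ a * A′ * (p^ a * A′) * G * p^ h  ≡⟨ cong (λ A → A * A * G * p^ h) A≡ ⟨
      A * A * G * H                       ∎
      where
      identity : ∀ π π′ δ A′ G → π * A′ * (π′ * A′) * (δ * G) ≡ π * π′ * δ * (A′ * A′ * G)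
      identity = solve-∀
      identity′ : ∀ π π′ η A′ G → π * π′ * η * (A′ * A′ * G) ≡ π * A′ * (π′ * A′) * G * η
      identity′ = solve-∀
      exponents : p^ ν * p^ ν * p^ e ≡ p^ a * p^ a * p^ h
      exponents = trans (sym (p^-+³ ν ν e)) (trans (cong p^_ (sum a r e)) (p^-+³ a a h))
        where
        sum : ∀ a r e → a ℕ.+ suc r ℕ.+ (a ℕ.+ suc r) ℕ.+ e ≡ a ℕ.+ a ℕ.+ (suc r ℕ.+ suc r ℕ.+ e)
        sum = ℕ-Solver.solve-∀

    open FamilyPoint unit κ G H on-surface G-unit (p∣p^ h (s≤s z≤n))

    Q : Quad
    Q = quadOf κ G H

    -- After dividing by p^ν A′, the Hilbert equation at xᵢ becomes the descent form in W = (1 − c) X.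
    residual≡ : ∀ X Y Z → hilbert-residual (x₀ Q) (xᵢ Q) X Y Z ≡ p^ ν * (A′ * form (Dₖ k₀) ((1ℤ - c) * X) Y Z)
    residual≡ X Y Z = trans (cong (λ D → c * κ * Z * Z - ((xᵢ Q - + 2 * x₀ Q) * X * X + c * κ * D * Y * Y)) m-4≡)
                            (identity c (p^ ν) A′ (Dₖ k₀) X Y Z)
      where
      identity : ∀ c π A′ D X Y Z →
        c * (π * A′) * Z * Z - (((1ℤ + c * c) * (π * A′) - + 2 * (c * (π * A′))) * X * X + c * (π * A′) * D * Y * Y)
          ≡ π * (A′ * (c * Z * Z - ((1ℤ - c) * X) * ((1ℤ - c) * X) - c * D * Y * Y))
      identity = solve-∀

    -- p^ν is absorbed by κ, p^σ by 1 − c = p^σ s′, and 2 k₀ + 3 is the threshold of the descent.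
    descent-depth depth : ℕ → ℕ
    descent-depth j = σ ℕ.+ j ℕ.+ (σ ℕ.+ j) ℕ.+ threshold k₀
    depth j = ν ℕ.+ descent-depth j

    j≤depth : ∀ j → j ≤ depth j
    j≤depth j = ℕ.≤-trans (ℕ.m≤n+m j σ) (ℕ.≤-trans (ℕ.m≤m+n (σ ℕ.+ j) (σ ℕ.+ j))
                  (ℕ.≤-trans (ℕ.m≤m+n (σ ℕ.+ j ℕ.+ (σ ℕ.+ j)) (threshold k₀)) (ℕ.m≤n+m (descent-depth j) ν)))

    p^j∣-of-residual : ∀ j X Y Z → p^ depth j ∣ hilbert-residual (x₀ Q) (xᵢ Q) X Y Z →
      p^ j ∣ X × p^ j ∣ Y × p^ j ∣ Z
    p^j∣-of-residual j X Y Z p^∣residual =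
      let (p^∣W , p^∣Y , p^∣Z) =
            descent k₀ (σ ℕ.+ j) ((1ℤ - c) * X) Y Z
              (Unit-cancel-p^∣ (descent-depth j) (form (Dₖ k₀) ((1ℤ - c) * X) Y Z) A′-unit
                (p^-cancelˡ-∣ ν (descent-depth j) (subst (p^ depth j ∣_) (residual≡ X Y Z) p^∣residual)))
      in  Unit-cancel-p^∣ j X s′-unit (p^-cancelˡ-∣ σ j (subst (p^ (σ ℕ.+ j) ∣_) (W≡ X) p^∣W)) ,
          ∣-trans (p^-mono-∣ (ℕ.m≤n+m j σ)) p^∣Y ,
          ∣-trans (p^-mono-∣ (ℕ.m≤n+m j σ)) p^∣Z
      where
      W≡ : ∀ X → (1ℤ - c) * X ≡ p^ σ * (s′ * X)
      W≡ X = trans (cong (_* X) 1-c≡) (ℤ.*-assoc (p^ σ) s′ X)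

    no-symbol : ∀ i → ¬ SymbolOne (familyPoint i) i
    no-symbol i (X , Y , Z , not-all-zero , equation) =
      not-all-zero ( ≈0-of-deep-representatives X depth j≤depth (proj₁ ∘ deep)
                   , ≈0-of-deep-representatives Y depth j≤depth (proj₁ ∘ proj₂ ∘ deep)
                   , ≈0-of-deep-representatives Z depth j≤depth (proj₂ ∘ proj₂ ∘ deep) )
      where
      deep : ∀ j → p^ j ∣ seq X (depth j) × p^ j ∣ seq Y (depth j) × p^ j ∣ seq Z (depth j)
      deep j = p^j∣-of-residual j (seq X (depth j)) (seq Y (depth j)) (seq Z (depth j))
        (subst (λ v → p^ depth j ∣ hilbert-residual (x₀ Q) v (seq X (depth j)) (seq Y (depth j)) (seq Z (depth j)))
          (at-self i Q)
          (∣ᵤ⇒∣ {p^ depth j} {hilbert-residual (x₀ Q) (at i Q i) (seq X (depth j)) (seq Y (depth j)) (seq Z (depth j))}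
            (equation (depth j))))

    ν-allowed : ∀ k → Allowed k (suc w′) ν
    ν-allowed k = subst (Allowed k (suc w′)) (sym (ℕ.+-suc a r)) (allowed-multiple k (suc w′) a)

    symbol-point : ∀ k ω i → ω i ≡ just (suc w′) → ∃ λ (N : Point p m) → StrPoint k ω N × InvHalf N i
    symbol-point k ω i ωᵢ≡w =
      familyPoint i ,
      familyPoint-str k ω i ωᵢ≡w ν refl A′-unit (ν-allowed k) ,
      Ul≠2-of i Q (quadOf-on-surface on-surface) xⱼ-unit i
        (subst (λ v → v - + 2 * x₀ Q ≢ 0ℤ) (sym (at-self i Q))
          (subst (_≢ 0ℤ) (sym (xᵢ-2x₀ κ G H)) (*-≢0 (*-≢0 (1-c≢0 A≢0) (1-c≢0 A≢0)) (p^*unit≢0 ν A′-unit)))) ,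
      no-symbol i

  nontrivial-symbol-point : OddVal p (m - + 4) → ∀ k ω i {w} → ω i ≡ just w → 1 ≤ w →
    ∃ λ (N : Point p m) → StrPoint k ω N × InvHalf N i
  nontrivial-symbol-point _ k ω i {zero} _ ()
  nontrivial-symbol-point (k₀ , p^∣m-4 , p^∤m-4) k ω i {suc w′} ωᵢ≡w _ =
    let (c , c-nonsquare) = ∃-unramified-nonsquare p p-prime
    in  NontrivialSymbol.symbol-point {k₀} m-4≡ D′-unit c-nonsquare w′ k ω i ωᵢ≡w
    where
    2k₀≡ : 2 ℕ.* k₀ ≡ k₀ ℕ.+ k₀
    2k₀≡ = cong (k₀ ℕ.+_) (ℕ.+-identityʳ k₀)
    p^∣ : p^ suc (k₀ ℕ.+ k₀) ∣ m - + 4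
    p^∣ = subst (λ n → p^ suc n ∣ m - + 4) 2k₀≡ (∣ᵤ⇒∣ {p^ suc (2 ℕ.* k₀)} {m - + 4} p^∣m-4)
    D′ : ℤ
    D′ = quotient p^∣
    m-4≡ : m - + 4 ≡ p^ suc (k₀ ℕ.+ k₀) * D′
    m-4≡ = trans (_∣_.equality p^∣) (ℤ.*-comm D′ (p^ suc (k₀ ℕ.+ k₀)))
    D′-unit : Unit D′
    D′-unit p∣D′ = p^∤m-4 (∣⇒∣ᵤ
      (subst₂ _∣_ (cong (λ n → p^ suc (suc n)) (sym 2k₀≡)) (sym (_∣_.equality p^∣))
        (subst (_∣ D′ * p^ suc (k₀ ℕ.+ k₀)) (sym (p^-suc (suc (k₀ ℕ.+ k₀))))
          (*-pres-∣ p∣D′ (∣-refl {p^ suc (k₀ ℕ.+ k₀)})))))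

proposition3p6 : (m : ℤ) → m ≢ + 0 → m ≢ + 4 → (p : ℕ) → Prime p →
    (ω : Fin 3 → Maybe ℕ) → (∀ l w → ω l ≡ just w → 2 ≤ w) →
    (∃ λ l → ∃ λ w → ω l ≡ just w) → (k : Kind) →
    (∃ λ (M : Point p m) → StrPoint k ω M × (∀ l → Inv0 M l))
    × (∀ i w → ω i ≡ just w → OddVal p (m - + 4) →
         ∃ λ (N : Point p m) → StrPoint k ω N × InvHalf N i)
proposition3p6 m _ m≢4 p p-prime ω 2≤ω (i , w , ωᵢ≡w) k =
  trivial-symbols-point {d} m-4≡ D′-unit k ω i ωᵢ≡w (2≤ω i w ωᵢ≡w) ,
  λ i′ w′ ωᵢ′≡w′ odd →
    nontrivial-symbol-point odd k ω i′ ωᵢ′≡w′ (ℕ.≤-trans (s≤s z≤n) (2≤ω i′ w′ ωᵢ′≡w′))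
  where
  open PrimePowers p p-prime
  open Construction p p-prime m
  open Valuation (valuation (m≢4 ∘ ℤ.i-j≡0⇒i≡j m (+ 4))) using ()
    renaming (ν to d; u to D′; z≡p^ν*u to m-4≡; u-unit to D′-unit)
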